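{- Let $k\ge 4$ be an even integer. If $\Gamma\in M_{0,1,\ldots,k-1}$ (as described in the context), then $\Gamma$ has a Fulkerson-cover, i.e. there exist six perfect matchings of $\Gamma$ such that every edge of $\Gamma$ belongs to exactly two of them.
   Context: All graphs are finite and simple. A Fulkerson-cover of a cubic graph is a collection of six perfect matchings such that each edge lies in exactly two of them. A cubic graph is cyclically $4$-edge-connected if at least $4$ edges must be removed to disconnect it into two components each containing a circuit. The family $M_{0,1,\ldots,k-1}$ ($k\ge 2$). Let $G_0,\ldots,G_{k-1}$ be cyclically $4$-edge-connected bridgeless cubic graphs, each having a Fulkerson-cover. In each $G_i$ choose an edge $x_iy_i$; let $x_i^0,x_i^1$ be the two neighbours of $x_i$ other than $y_i$, and $y_i^0,y_i^1$ the two neighbours of $y_i$ other than $x_i$. Let $H_i=G_i\setminus\{x_i,y_i\}$. For $k=2$, $\{G;G_0,G_1\}$ is obtained from the disjoint union of $H_0,H_1$ by adding vertices $a_0,b_0,c_0,a_1,b_1,c_1$ and the 13 edges $a_0y_0^0, a_0x_1^0, a_0c_0, c_0b_0, b_0y_0^1, b_0x_1^1, b_1x_0^1, b_1y_1^1, b_1c_1, c_1a_1, a_1x_0^0, a_1y_1^0, c_0c_1$. For $3\le i\le k$, $\{G;G_0,\ldots,G_{i-1}\}$ is obtained from $\{G;G_0,\ldots,G_{i-2}\}$ as follows: add a copy of $H_{i-1}$ and new vertices $a_{i-1},b_{i-1},c_{i-1}$; subdivide by a new vertex $v_{i-3}$ the unique edge $e_0$ incident with $c_0$ that is not in any $H_j$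 and is not one of $a_jc_j,c_jb_j$; delete the edges $a_{i-2}x_0^0$ and $b_{i-2}x_0^1$ and add the edges $a_{i-2}x_{i-1}^0$, $b_{i-2}x_{i-1}^1$, $a_{i-1}x_0^0$, $a_{i-1}y_{i-1}^0$, $b_{i-1}x_0^1$, $b_{i-1}y_{i-1}^1$, $c_{i-1}a_{i-1}$, $c_{i-1}b_{i-1}$, $c_{i-1}v_{i-3}$; all other edges remain the same. Equivalently, $\{G;G_0,\ldots,G_{k-1}\}$ consists of $H_0,\ldots,H_{k-1}$, vertices $a_i,b_i,c_i$ ($0\le i\le k-1$) and $v_0,\ldots,v_{k-3}$, with edges $a_ic_i$, $b_ic_i$, $a_iy_i^0$, $a_ix_{i+1}^0$, $b_iy_i^1$, $b_ix_{i+1}^1$ (indices mod $k$), the path $c_0v_{k-3}v_{k-4}\cdots v_0c_1$ (the single edge $c_0c_1$ if $k=2$), and the edges $c_iv_{i-2}$ for $2\le i\le k-1$. The family of all graphs so obtained (over all choices of the $G_i$ and edges $x_iy_i$) is $M_{0,1,\ldots,k-1}$. -}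

module Defs where

open import Data.Nat using (ℕ; zero; suc; _+_; _∸_)
open import Data.Fin using (Fin; toℕ; inject₁; fromℕ) renaming (zero to fzero; suc to fsuc)
open import Data.Bool using (Bool; true; false; not; T)
open import Data.Product using (Σ; ∃; _×_; _,_)
open import Data.Sum using (_⊎_)
open import Relation.Nullary using (¬_)
open import Relation.Binary.PropositionalEquality using (_≡_; _≢_)
open import Relation.Binary.Construct.Closure.ReflexiveTransitive using (Star)
open import Function.Definitions using (Injective)

record Graph : Set₁ where
  field
    V   : Set
    Adj : V → V → Set

open Graph public

record SimpleFinGraph (n : ℕ) : Set where
  field
    adj        : Fin n → Fin n → Bool
    adj-sym    : ∀ u v → adj u v ≡ adj v u
    adj-irrefl : ∀ v → adj v v ≡ false

open SimpleFinGraph public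

toGraph : ∀ {n} → SimpleFinGraph n → Graph
toGraph {n} G = record { V = Fin n ; Adj = λ u v → T (adj G u v) }

module _ (G : Graph) where
  private
    W = V G
    A = Adj G

  Cubic : Set
  Cubic = ∀ v → Σ (Fin 3 → W) λ f →
            Injective _≡_ _≡_ f × (∀ i → A v (f i)) × (∀ w → A v w → ∃ λ i → f i ≡ w)

  AdjWithout : W → W → W → W → Set
  AdjWithout u v a b = A a b × ¬ (a ≡ u × b ≡ v) × ¬ (a ≡ v × b ≡ u)

  Bridgeless : Set
  Bridgeless = ∀ u v → A u v → Star (AdjWithout u v) u v

  HasCircuitIn : (W → Bool) → Set
  HasCircuitIn S = Σ ℕ λ m → Σ (Fin (suc (suc (suc m))) → W) λ f →
      Injective _≡_ _≡_ f
    × (∀ i → T (S (f i)))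
    × (∀ (i : Fin (suc (suc m))) → A (f (inject₁ i)) (f (fsuc i)))
    × A (f (fromℕ (suc (suc m)))) (f fzero)

  -- an edge of the cut δ(S), oriented from S to its complement
  InCut : (W → Bool) → W × W → Set
  InCut S (u , v) = T (S u) × T (not (S v)) × A u v

  CutAtLeast4 : (W → Bool) → Set
  CutAtLeast4 S = Σ (Fin 4 → W × W) λ f → Injective _≡_ _≡_ f × (∀ i → InCut S (f i))

  Cyclically4EdgeConnected : Set
  Cyclically4EdgeConnected = ∀ (S : W → Bool) →
    HasCircuitIn S → HasCircuitIn (λ w → not (S w)) → CutAtLeast4 S

  IsPerfectMatching : (W → W → Set) → Set
  IsPerfectMatching M =
      (∀ u v → M u v → A u v)
    × (∀ u v → M u v → M v u)
    × (∀ v → ∃ λ w → M v w × (∀ w' → M v w' → w' ≡ w))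

  ExactlyTwo : (Fin 6 → Set) → Set
  ExactlyTwo P = Σ (Fin 6) λ j₁ → Σ (Fin 6) λ j₂ →
    j₁ ≢ j₂ × P j₁ × P j₂ × (∀ j → P j → j ≡ j₁ ⊎ j ≡ j₂)

  HasFulkersonCover : Set₁
  HasFulkersonCover = Σ (Fin 6 → W → W → Set) λ M →
    (∀ j → IsPerfectMatching (M j)) × (∀ u v → A u v → ExactlyTwo (λ j → M j u v))

module Construction (k : ℕ) (n : Fin k → ℕ) (G : (i : Fin k) → SimpleFinGraph (n i))
                    (x y x0 x1 y0 y1 : (i : Fin k) → Fin (n i)) where

  -- vertices: those of H_i = G_i - {x_i, y_i}, a_i, b_i, c_i, and v_0 .. v_{k-3}
  data Vtx : Set where
    hv : (i : Fin k) (v : Fin (n i)) .(vx : v ≢ x i) .(vy : v ≢ y i) → Vtx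
    av : Fin k → Vtx
    bv : Fin k → Vtx
    cv : Fin k → Vtx
    vv : Fin (k ∸ 2) → Vtx

  Next : Fin k → Fin k → Set
  Next i j = suc (toℕ i) ≡ toℕ j ⊎ (suc (toℕ i) ≡ k × toℕ j ≡ 0)

  -- edges (each listed once, in one orientation)
  data E : Vtx → Vtx → Set where
    eH  : ∀ i u w .(ux : u ≢ x i) .(uy : u ≢ y i) .(wx : w ≢ x i) .(wy : w ≢ y i) →
          T (adj (G i) u w) → E (hv i u ux uy) (hv i w wx wy)
    eAC : ∀ i → E (av i) (cv i)
    eBC : ∀ i → E (bv i) (cv i)
    eAY : ∀ i .(p : y0 i ≢ x i) .(q : y0 i ≢ y i) → E (av i) (hv i (y0 i) p q)
    eAX : ∀ i j → Next i j → .(p : x0 j ≢ x j) .(q : x0 j ≢ y j) → E (av i) (hv j (x0 j) p q)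
    eBY : ∀ i .(p : y1 i ≢ x i) .(q : y1 i ≢ y i) → E (bv i) (hv i (y1 i) p q)
    eBX : ∀ i j → Next i j → .(p : x1 j ≢ x j) .(q : x1 j ≢ y j) → E (bv i) (hv j (x1 j) p q)
    -- the path c_0 v_{k-3} v_{k-4} ... v_0 c_1 (the edge c_0 c_1 if k = 2)
    eC0C1 : ∀ i j → k ≡ 2 → toℕ i ≡ 0 → toℕ j ≡ 1 → E (cv i) (cv j)
    eC0V  : ∀ i j → toℕ i ≡ 0 → suc (suc (suc (toℕ j))) ≡ k → E (cv i) (vv j)
    eVV   : ∀ j j' → toℕ j' ≡ suc (toℕ j) → E (vv j') (vv j)
    eVC1  : ∀ j i → toℕ j ≡ 0 → toℕ i ≡ 1 → E (vv j) (cv i)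
    eCV   : ∀ i j → toℕ i ≡ suc (suc (toℕ j)) → E (cv i) (vv j)

  Γ : Graph
  Γ = record { V = Vtx ; Adj = λ u v → E u v ⊎ E v u }

record MData (k : ℕ) : Set₁ where
  field
    n  : Fin k → ℕ
    G  : (i : Fin k) → SimpleFinGraph (n i)
    cubic       : ∀ i → Cubic (toGraph (G i))
    bridgeless  : ∀ i → Bridgeless (toGraph (G i))
    cyc4        : ∀ i → Cyclically4EdgeConnected (toGraph (G i))
    fulkerson   : ∀ i → HasFulkersonCover (toGraph (G i))
    x y x0 x1 y0 y1 : (i : Fin k) → Fin (n i)
    xy   : ∀ i → T (adj (G i) (x i) (y i))
    xx0  : ∀ i → T (adj (G i) (x i) (x0 i))
    xx1  : ∀ i → T (adj (G i) (x i) (x1 i))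
    yy0  : ∀ i → T (adj (G i) (y i) (y0 i))
    yy1  : ∀ i → T (adj (G i) (y i) (y1 i))
    x0≢x1 : ∀ i → x0 i ≢ x1 i
    x0≢y  : ∀ i → x0 i ≢ y i
    x1≢y  : ∀ i → x1 i ≢ y i
    y0≢y1 : ∀ i → y0 i ≢ y1 i
    y0≢x  : ∀ i → y0 i ≢ x i
    y1≢x  : ∀ i → y1 i ≢ x i

MGraph : ∀ {k} → MData k → Graph
MGraph {k} D = Construction.Γ k n G x y x0 x1 y0 y1
  where open MData D

-- Split the six colours of the new graph Γ into three slots α, β, γ of two.
-- At the edge x_i y_i of G_i, two colours of its Fulkerson cover contain
-- x_i y_i and the other four form two pairs, each pair matching x_i to x_i⁰
-- and x_i¹ and, correspondingly, y_i to y_i⁰ and y_i¹ in some order.  For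
-- each i we let one slot of Γ restrict on H_i to the two colours through
-- x_i y_i and the other slots to the two pairs.  At the gadget a_i b_i c_i,
-- in each slot either both G_i and G_{i+1} send edges to a_i and b_i, and
-- c_i is matched along the spine c_1 v_0 … v_{k-3} c_0 with its pendant
-- edges c_{j+2} v_j, or exactly one of them uses its edge xy and c_i takes
-- the free vertex among a_i, b_i.  Blocking the slots β, γ, β, α, β, α, …, α
-- at G_0, G_1, …, G_{k-1} makes the spine slot α at c_0, c_1 and γ at the
-- other c_i; the spine is then covered by c_1 v_0, v_1 v_2, …, v_{k-3} c_0 in
-- slot α, by v_0 v_1, v_2 v_3, … in slot β and by the pendant edges in slot γ.
-- Both the blocking pattern and the slot-α matching of the spine need k even,
-- and the orientations of the pairs are chosen along each spine chain so that
-- consecutive ends never meet at the same vertex of a gadget.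

module Submission where

open import Defs
open import Data.Nat using (ℕ; suc; _+_; _*_; _≤_; _<_; z≤n; s≤s; _<?_)
import Data.Nat.Properties as ℕ
open import Data.Nat.Divisibility using (_∣_; divides)
open import Data.Fin using (Fin; toℕ; fromℕ; fromℕ<; inject₁; punchOut) renaming (zero to fzero; suc to fsuc)
open import Data.Fin.Properties
  using (_≟_; punchOut-injective; toℕ-injective; toℕ<n; toℕ-fromℕ; toℕ-fromℕ<; toℕ-inject₁;
         fromℕ<-toℕ)
open import Data.Fin.Patterns using (0F; 1F; 2F; 3F; 4F; 5F)
open import Data.Bool using (Bool; true; false; not; T; _xor_; if_then_else_)
open import Data.Maybe using (Maybe; just; nothing)
open import Data.Bool.Properties using (not-involutive; xor-assoc; xor-comm; not-distribˡ-xor)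
open import Data.Product using (Σ; ∃; _×_; _,_; proj₁; proj₂)
open import Data.Sum using (_⊎_; inj₁; inj₂)
import Data.Sum as Sum
open import Data.Empty using (⊥; ⊥-elim)
import Data.Empty.Irrelevant as Irrelevant
open import Function using (_∘_; _↔_; Inverse; mk↔ₛ′)
open import Function.Construct.Composition using (_↔-∘_)
open import Function.Construct.Symmetry using (↔-sym)
open import Relation.Nullary using (¬_; yes; no; does)
open import Relation.Binary.PropositionalEquality using (_≡_; _≢_; refl; sym; trans; cong; cong₂; subst; subst₂)
open Relation.Binary.PropositionalEquality.≡-Reasoning

record Pair (P : Fin 6 → Set) : Set where
  field
    pick      : Bool → Fin 6
    distinct  : pick false ≢ pick true
    satisfies : ∀ b → P (pick b)
    onto      : ∀ j → P j → ∃ λ b → pick b ≡ j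

  pick-injective : ∀ {b b′} → pick b ≡ pick b′ → b ≡ b′
  pick-injective {false} {false} _ = refl
  pick-injective {false} {true}  e = ⊥-elim (distinct e)
  pick-injective {true}  {false} e = ⊥-elim (distinct (sym e))
  pick-injective {true}  {true}  _ = refl

open Pair

module _ {G : Graph} {P : Fin 6 → Set} where

  exactlyTwo⇒pair : ExactlyTwo G P → Pair P
  exactlyTwo⇒pair (j₁ , j₂ , j₁≢j₂ , Pj₁ , Pj₂ , only) = record
    { pick      = choose
    ; distinct  = j₁≢j₂
    ; satisfies = λ { false → Pj₁ ; true → Pj₂ }
    ; onto      = onto′
    }
    where
    choose : Bool → Fin 6
    choose false = j₁
    choose true  = j₂
    onto′ : ∀ j → P j → ∃ λ b → choose b ≡ j
    onto′ j Pj with only j Pj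
    ... | inj₁ e = false , sym e
    ... | inj₂ e = true , sym e

  pair⇒exactlyTwo : Pair P → ExactlyTwo G P
  pair⇒exactlyTwo p =
    pick p false , pick p true , distinct p , satisfies p false , satisfies p true , only
    where
    only : ∀ j → P j → j ≡ pick p false ⊎ j ≡ pick p true
    only j Pj with onto p j Pj
    ... | false , e = inj₁ (sym e)
    ... | true  , e = inj₂ (sym e)

pair-⇔ : ∀ {P Q : Fin 6 → Set} → (∀ j → P j → Q j) → (∀ j → Q j → P j) → Pair P → Pair Q
pair-⇔ P⇒Q Q⇒P p = record
  { pick      = pick p
  ; distinct  = distinct p
  ; satisfies = P⇒Q _ ∘ satisfies p
  ; onto      = λ j → onto p j ∘ Q⇒P j
  }

pair-↔ : ∀ {P : Fin 6 → Set} (π : Fin 6 ↔ Fin 6) → Pair P → Pair (P ∘ Inverse.to π)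
pair-↔ {P} π p = record
  { pick      = from ∘ pick p
  ; distinct  = distinct p ∘ from-injective
  ; satisfies = λ b → subst P (sym (strictlyInverseˡ (pick p b))) (satisfies p b)
  ; onto      = λ c Pc → let b , e = onto p (to c) Pc in
                         b , trans (cong from e) (strictlyInverseʳ c)
  }
  where
  open Inverse π
  from-injective : ∀ {i j} → from i ≡ from j → i ≡ j
  from-injective {i} {j} e =
    trans (sym (strictlyInverseˡ i)) (trans (cong to e) (strictlyInverseˡ j))

pair-swap : ∀ {P : Fin 6 → Set} → Pair P → Pair P
pair-swap p = record
  { pick      = pick p ∘ not
  ; distinct  = distinct p ∘ sym
  ; satisfies = satisfies p ∘ not
  ; onto      = λ j Pj → let b , e = onto p j Pj in
                         not b , trans (cong (pick p) (not-involutive b)) e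
  }

pair-startingAt : ∀ {P : Fin 6 → Set} (p : Pair P) {j} → P j →
                  Σ (Pair P) λ p′ → pick p′ false ≡ j
pair-startingAt p {j} Pj with onto p j Pj
... | false , e = p , e
... | true  , e = pair-swap p , e

pair-other : ∀ {P : Fin 6 → Set} (p : Pair P) {j} → P j → j ≢ pick p false → pick p true ≡ j
pair-other p {j} Pj j≢first with onto p j Pj
... | false , e = ⊥-elim (j≢first (sym e))
... | true  , e = e

module PerfectMatching {G : Graph} {M : V G → V G → Set} (pm : IsPerfectMatching G M) where

  partner : V G → V G
  partner v = proj₁ (proj₂ (proj₂ pm) v)

  partner-matched : ∀ v → M v (partner v)
  partner-matched v = proj₁ (proj₂ (proj₂ (proj₂ pm) v))

  matched⇒partner : ∀ {u w} → M u w → w ≡ partner u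
  matched⇒partner {u} {w} m = proj₂ (proj₂ (proj₂ (proj₂ pm) u)) w m

  matched-functional : ∀ {u v w} → M u v → M u w → v ≡ w
  matched-functional m m′ = trans (matched⇒partner m) (sym (matched⇒partner m′))

  matched-sym : ∀ {u w} → M u w → M w u
  matched-sym {u} {w} = proj₁ (proj₂ pm) u w

  matched-adj : ∀ {u w} → M u w → Adj G u w
  matched-adj {u} {w} = proj₁ pm u w

involution⇒perfectMatching : ∀ {G : Graph} (f : V G → V G) →
  (∀ v → Adj G v (f v)) → (∀ v → f (f v) ≡ v) → IsPerfectMatching G (λ u w → f u ≡ w)
involution⇒perfectMatching {G} f adj invol =
    (λ u w e → subst (Adj G u) e (adj u))
  , (λ u w e → trans (cong f (sym e)) (invol u))
  , (λ v → f v , refl , λ w e → sym e)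

Fin3-covered : ∀ {a b c : Fin 3} → a ≢ b → a ≢ c → b ≢ c → ∀ w → w ≡ a ⊎ w ≡ b ⊎ w ≡ c
Fin3-covered {a} {b} {c} a≢b a≢c b≢c w with w ≟ a | w ≟ b | w ≟ c
... | yes w≡a | _       | _       = inj₁ w≡a
... | no _    | yes w≡b | _       = inj₂ (inj₁ w≡b)
... | no _    | no _    | yes w≡c = inj₂ (inj₂ w≡c)
... | no w≢a  | no w≢b  | no w≢c  =
  ⊥-elim (w≢c (punchOut-injective a≢w a≢c
                 (punchOut-injective b′≢w′ b′≢c′ (Fin1-unique _ _))))
  where
  a≢w = w≢a ∘ sym
  b′≢w′ : punchOut a≢b ≢ punchOut a≢w
  b′≢w′ = w≢b ∘ sym ∘ punchOut-injective a≢b a≢w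
  b′≢c′ : punchOut a≢b ≢ punchOut a≢c
  b′≢c′ = b≢c ∘ punchOut-injective a≢b a≢c
  Fin1-unique : (i j : Fin 1) → i ≡ j
  Fin1-unique fzero fzero = refl

cubic-neighbours : ∀ {G : Graph} → Cubic G → ∀ {v a b c w} →
  Adj G v a → Adj G v b → Adj G v c → a ≢ b → a ≢ c → b ≢ c →
  Adj G v w → w ≡ a ⊎ w ≡ b ⊎ w ≡ c
cubic-neighbours cubic {v} va vb vc a≢b a≢c b≢c vw with cubic v
... | f , _ , _ , onto with onto _ va | onto _ vb | onto _ vc | onto _ vw
... | ia , refl | ib , refl | ic , refl | iw , refl =
  Sum.map (cong f) (Sum.map (cong f) (cong f))
    (Fin3-covered (a≢b ∘ cong f) (a≢c ∘ cong f) (b≢c ∘ cong f) iw)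

data EdgeAtX : Set where
  toY : EdgeAtX
  toX : Bool → EdgeAtX

module AtVertex {G : Graph} (cubic : Cubic G)
  (M : Fin 6 → V G → V G → Set) (pm : ∀ j → IsPerfectMatching G (M j))
  {x y x₀ x₁ : V G} (x~y : Adj G x y) (x~x₀ : Adj G x x₀) (x~x₁ : Adj G x x₁)
  (y≢x₀ : y ≢ x₀) (y≢x₁ : y ≢ x₁) (x₀≢x₁ : x₀ ≢ x₁) where

  xs : Bool → V G
  xs false = x₀
  xs true  = x₁

  endpoint : EdgeAtX → V G
  endpoint toY     = y
  endpoint (toX s) = xs s

  endpoint-injective : ∀ {e e′} → endpoint e ≡ endpoint e′ → e ≡ e′
  endpoint-injective {toY}       {toY}       _ = refl
  endpoint-injective {toY}       {toX false} e = ⊥-elim (y≢x₀ e)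
  endpoint-injective {toY}       {toX true}  e = ⊥-elim (y≢x₁ e)
  endpoint-injective {toX false} {toY}       e = ⊥-elim (y≢x₀ (sym e))
  endpoint-injective {toX true}  {toY}       e = ⊥-elim (y≢x₁ (sym e))
  endpoint-injective {toX false} {toX false} _ = refl
  endpoint-injective {toX false} {toX true}  e = ⊥-elim (x₀≢x₁ e)
  endpoint-injective {toX true}  {toX false} e = ⊥-elim (x₀≢x₁ (sym e))
  endpoint-injective {toX true}  {toX true}  _ = refl

  module _ (j : Fin 6) where
    open PerfectMatching (pm j)

    edgeAt : Σ EdgeAtX λ e → M j x (endpoint e)
    edgeAt with cubic-neighbours cubic x~y x~x₀ x~x₁ y≢x₀ y≢x₁ x₀≢x₁ (matched-adj (partner-matched x))
    ... | inj₁ e         = toY   , subst (M j x) e (partner-matched x)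
    ... | inj₂ (inj₁ e)  = toX false , subst (M j x) e (partner-matched x)
    ... | inj₂ (inj₂ e)  = toX true  , subst (M j x) e (partner-matched x)

  coloursAt : (∀ e → Pair (λ j → M j x (endpoint e))) → (EdgeAtX × Bool) ↔ Fin 6
  coloursAt class = mk↔ₛ′ colour index colour-index index-colour
    where
    colour : EdgeAtX × Bool → Fin 6
    colour (e , b) = pick (class e) b

    index : Fin 6 → EdgeAtX × Bool
    index j = let e , m = edgeAt j in e , proj₁ (onto (class e) j m)

    colour-index : ∀ j → colour (index j) ≡ j
    colour-index j = let e , m = edgeAt j in proj₂ (onto (class e) j m)

    colour-injective : ∀ {e e′ b b′} → pick (class e) b ≡ pick (class e′) b′ → (e , b) ≡ (e′ , b′)
    colour-injective {e} {e′} {b} {b′} eq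
      with endpoint-injective {e} {e′} (PerfectMatching.matched-functional (pm _)
             (satisfies (class e) b) (subst (λ j → M j x _) (sym eq) (satisfies (class e′) b′)))
    ... | refl = cong (e ,_) (pick-injective (class e) eq)

    index-colour : ∀ c → index (colour c) ≡ c
    index-colour c = colour-injective (colour-index (colour c))

-- The colours avoiding xy form two pairs; the colour of pair k whose x-end
-- is x_s has y-end y_(s xor twist k).

data Kind : Set where
  viaXY : Kind
  pair  : Bool → Kind

Role : Set
Role = Kind × Bool

data EndState : Set where
  usesXY : EndState
  ends   : (s t : Bool) → EndState

roleState : (Bool → Bool) → Role → EndState
roleState twist (viaXY  , _) = usesXY
roleState twist (pair k , s) = ends s (s xor twist k)

xEnd yEnd : EndState → Maybe Bool
xEnd usesXY     = nothing
xEnd (ends s t) = just s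
yEnd usesXY     = nothing
yEnd (ends s t) = just t

regroup : Role ↔ (EdgeAtX × Bool)
regroup = mk↔ₛ′ to from (λ { (toY , b) → refl ; (toX s , k) → refl })
                        (λ { (viaXY , b) → refl ; (pair k , s) → refl })
  where
  to : Role → EdgeAtX × Bool
  to (viaXY  , b) = toY , b
  to (pair k , s) = toX s , k
  from : EdgeAtX × Bool → Role
  from (toY   , b) = viaXY , b
  from (toX s , k) = pair k , s

module AtEdge {G : Graph} (cubic : Cubic G)
  (M : Fin 6 → V G → V G → Set) (pm : ∀ j → IsPerfectMatching G (M j))
  (ex : ∀ u w → Adj G u w → ExactlyTwo G (λ j → M j u w))
  {x y x₀ x₁ y₀ y₁ : V G}
  (x~y : Adj G x y) (y~x : Adj G y x) (x~x₀ : Adj G x x₀) (x~x₁ : Adj G x x₁)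
  (y~y₀ : Adj G y y₀) (y~y₁ : Adj G y y₁)
  (x₀≢x₁ : x₀ ≢ x₁) (x₀≢y : x₀ ≢ y) (x₁≢y : x₁ ≢ y)
  (y₀≢y₁ : y₀ ≢ y₁) (y₀≢x : y₀ ≢ x) (y₁≢x : y₁ ≢ x) where

  open AtVertex cubic M pm x~y x~x₀ x~x₁ (x₀≢y ∘ sym) (x₁≢y ∘ sym) x₀≢x₁
    using (endpoint; edgeAt; coloursAt)
  open AtVertex cubic M pm x~y x~x₀ x~x₁ (x₀≢y ∘ sym) (x₁≢y ∘ sym) x₀≢x₁
    public using (xs)

  ys : Bool → V G
  ys false = y₀
  ys true  = y₁

  Realises : Fin 6 → EndState → Set
  Realises j usesXY     = M j x y
  Realises j (ends s t) = M j x (xs s) × M j y (ys t)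

  record EdgeColouring : Set where
    field
      role     : Role ↔ Fin 6
      twist    : Bool → Bool
      realises : ∀ r → Realises (Inverse.to role r) (roleState twist r)

  xs≢y : ∀ s → xs s ≢ y
  xs≢y false = x₀≢y
  xs≢y true  = x₁≢y

  ys≢x : ∀ t → ys t ≢ x
  ys≢x false = y₀≢x
  ys≢x true  = y₁≢x

  private
    matched-functional : ∀ {j u v w} → M j u v → M j u w → v ≡ w
    matched-functional = PerfectMatching.matched-functional (pm _)

    matched-sym : ∀ {j u w} → M j u w → M j w u
    matched-sym = PerfectMatching.matched-sym (pm _)

    xs-injective : ∀ {s s′} → xs s ≡ xs s′ → s ≡ s′
    xs-injective {false} {false} _ = refl
    xs-injective {false} {true}  e = ⊥-elim (x₀≢x₁ e)
    xs-injective {true}  {false} e = ⊥-elim (x₀≢x₁ (sym e))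
    xs-injective {true}  {true}  _ = refl

    ys-injective : ∀ {t t′} → ys t ≡ ys t′ → t ≡ t′
    ys-injective {false} {false} _ = refl
    ys-injective {false} {true}  e = ⊥-elim (y₀≢y₁ e)
    ys-injective {true}  {false} e = ⊥-elim (y₀≢y₁ (sym e))
    ys-injective {true}  {true}  _ = refl

  realises-xEnd : ∀ {j st s} → Realises j st → M j x (xs s) → xEnd st ≡ just s
  realises-xEnd {st = usesXY}   {s} j~y     j~xs = ⊥-elim (xs≢y s (matched-functional j~xs j~y))
  realises-xEnd {st = ends _ _}     (j~xs′ , _) j~xs = cong just (xs-injective (matched-functional j~xs′ j~xs))

  realises-yEnd : ∀ {j st t} → Realises j st → M j y (ys t) → yEnd st ≡ just t
  realises-yEnd {st = usesXY}   {t = t} j~y j~ys = ⊥-elim (ys≢x t (matched-functional j~ys (matched-sym j~y)))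
  realises-yEnd {st = ends _ _} (_ , j~ys′) j~ys = cong just (ys-injective (matched-functional j~ys′ j~ys))

  xEnd-realised : ∀ {j st s} → Realises j st → xEnd st ≡ just s → M j x (xs s)
  xEnd-realised {st = ends _ _} (j~xs , _) refl = j~xs

  yEnd-realised : ∀ {j st t} → Realises j st → yEnd st ≡ just t → M j y (ys t)
  yEnd-realised {st = ends _ _} (_ , j~ys) refl = j~ys

  private
    classOf : ∀ u w → Adj G u w → Pair (λ j → M j u w)
    classOf u w u~w = exactlyTwo⇒pair {G} (ex u w u~w)

    X : ∀ s → Pair (λ j → M j x (xs s))
    X false = classOf x x₀ x~x₀
    X true  = classOf x x₁ x~x₁

    yNeighbour : ∀ {j w} → M j y w → w ≡ x ⊎ w ≡ y₀ ⊎ w ≡ y₁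
    yNeighbour = cubic-neighbours cubic y~x y~y₀ y~y₁ (y₀≢x ∘ sym) (y₁≢x ∘ sym) y₀≢y₁
                   ∘ PerfectMatching.matched-adj (pm _)

    differentX : ∀ {j j′ s} → M j x (xs s) → M j′ x (xs (not s)) → j ≢ j′
    differentX {s = false} m m′ refl = x₀≢x₁ (matched-functional m m′)
    differentX {s = true}  m m′ refl = x₀≢x₁ (matched-functional m′ m)

  record YOrder : Set where
    field
      xPair : ∀ s → Pair (λ j → M j x (xs s))
      twist : Bool → Bool
      yEnds : ∀ s k → M (pick (xPair s) k) y (ys (s xor twist k))

  module _ (R : Pair (λ j → M j y y₀)) where

    y₀-end : ∀ {j} b → pick R b ≡ j → M j y y₀
    y₀-end b refl = satisfies R b

    y₁-end : ∀ {j s} → M j x (xs s) → j ≢ pick R false → j ≢ pick R true → M j y y₁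
    y₁-end {j} {s} j~xs j≢r j≢r′ = viaNeighbour (yNeighbour y~w) y~w
      where
      y~w = PerfectMatching.partner-matched (pm j) y
      viaNeighbour : ∀ {w} → w ≡ x ⊎ w ≡ y₀ ⊎ w ≡ y₁ → M j y w → M j y y₁
      viaNeighbour (inj₁ refl) y~x′ = ⊥-elim (xs≢y s (matched-functional j~xs (matched-sym y~x′)))
      viaNeighbour (inj₂ (inj₁ refl)) y~y₀′ with onto R j y~y₀′
      ... | false , e = ⊥-elim (j≢r (sym e))
      ... | true  , e = ⊥-elim (j≢r′ (sym e))
      viaNeighbour (inj₂ (inj₂ refl)) y~y₁′ = y~y₁′

    orderBothAt : ∀ s → M (pick R false) x (xs s) → M (pick R true) x (xs s) → YOrder
    orderBothAt false r~x₀ r′~x₀ = record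
      { xPair = λ { false → start ; true → X true }
      ; twist = λ _ → false
      ; yEnds = λ { false false → y₀-end false (sym first)
                  ; false true  → y₀-end true
                                      (sym (pair-other start r′~x₀ (r′≢r ∘ (λ e → trans e first))))
                  ; true k      → y₁-end (satisfies (X true) k)
                                    (differentX r~x₀ (satisfies (X true) k) ∘ sym)
                                    (differentX r′~x₀ (satisfies (X true) k) ∘ sym) }
      }
      where
      start = proj₁ (pair-startingAt (X false) r~x₀)
      first = proj₂ (pair-startingAt (X false) r~x₀)
      r′≢r : pick R true ≢ pick R false
      r′≢r = distinct R ∘ sym
    orderBothAt true r~x₁ r′~x₁ = record
      { xPair = λ { false → X false ; true → start }
      ; twist = λ _ → true
      ; yEnds = λ { false k     → y₁-end (satisfies (X false) k)
                                    (differentX r~x₁ (satisfies (X false) k) ∘ sym)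
                                    (differentX r′~x₁ (satisfies (X false) k) ∘ sym)
                  ; true false  → y₀-end false (sym first)
                  ; true true   → y₀-end true
                                      (sym (pair-other start r′~x₁ (r′≢r ∘ (λ e → trans e first)))) }
      }
      where
      start = proj₁ (pair-startingAt (X true) r~x₁)
      first = proj₂ (pair-startingAt (X true) r~x₁)
      r′≢r : pick R true ≢ pick R false
      r′≢r = distinct R ∘ sym

    orderSplit : M (pick R false) x x₀ → M (pick R true) x x₁ → YOrder
    orderSplit r~x₀ r′~x₁ = record
      { xPair = λ { false → P ; true → pair-swap Q }
      ; twist = λ k → k
      ; yEnds = λ { false false → y₀-end false (sym firstP)
                  ; false true  → y₁-end (satisfies P true)
                                    (λ e → distinct P (trans firstP (sym e)))
                                    (differentX (satisfies P true) r′~x₁)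
                  ; true false  → y₁-end (satisfies Q true)
                                    (differentX (satisfies Q true) r~x₀)
                                    (λ e → distinct Q (trans firstQ (sym e)))
                  ; true true   → y₀-end true (sym firstQ) }
      }
      where
      P = proj₁ (pair-startingAt (X false) r~x₀)
      firstP = proj₂ (pair-startingAt (X false) r~x₀)
      Q = proj₁ (pair-startingAt (X true) r′~x₁)
      firstQ = proj₂ (pair-startingAt (X true) r′~x₁)

    R-at-x : ∀ b → Σ Bool λ s → M (pick R b) x (xs s)
    R-at-x b with edgeAt (pick R b)
    ... | toY   , m = ⊥-elim (y₀≢x (matched-functional (satisfies R b) (matched-sym m)))
    ... | toX s , m = s , m

  yOrder : (R : Pair (λ j → M j y y₀)) → YOrder
  yOrder R with R-at-x R false | R-at-x R true
  ... | false , r~x₀ | false , r′~x₀ = orderBothAt R false r~x₀ r′~x₀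
  ... | true  , r~x₁ | true  , r′~x₁ = orderBothAt R true r~x₁ r′~x₁
  ... | false , r~x₀ | true  , r′~x₁ = orderSplit R r~x₀ r′~x₁
  ... | true  , r~x₁ | false , r′~x₀ = orderSplit (pair-swap R) r′~x₀ r~x₁

  edgeColouring : EdgeColouring
  edgeColouring = record
    { role     = coloursAt classAt ↔-∘ regroup
    ; twist    = twist
    ; realises = λ { (viaXY , b) → satisfies (classOf x y x~y) b
                   ; (pair k , s) → satisfies (xPair s) k , yEnds s k }
    }
    where
    open YOrder (yOrder (classOf y y₀ y~y₀))
    classAt : ∀ e → Pair (λ j → M j x (endpoint e))
    classAt toY     = classOf x y x~y
    classAt (toX s) = xPair s

data Slot : Set where
  α β γ : Slot

colour : Slot → Bool → Fin 6
colour α false = 0F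
colour α true  = 1F
colour β false = 2F
colour β true  = 3F
colour γ false = 4F
colour γ true  = 5F

slotOf : Fin 6 → Slot
slotOf 0F = α
slotOf 1F = α
slotOf 2F = β
slotOf 3F = β
slotOf 4F = γ
slotOf 5F = γ

positionOf : Fin 6 → Bool
positionOf 0F = false
positionOf 1F = true
positionOf 2F = false
positionOf 3F = true
positionOf 4F = false
positionOf 5F = true

colour-slotOf : ∀ c → colour (slotOf c) (positionOf c) ≡ c
colour-slotOf 0F = refl
colour-slotOf 1F = refl
colour-slotOf 2F = refl
colour-slotOf 3F = refl
colour-slotOf 4F = refl
colour-slotOf 5F = refl

slotOf-colour : ∀ s b → slotOf (colour s b) ≡ s
slotOf-colour α false = refl
slotOf-colour α true  = refl
slotOf-colour β false = refl
slotOf-colour β true  = refl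
slotOf-colour γ false = refl
slotOf-colour γ true  = refl

positionOf-colour : ∀ s b → positionOf (colour s b) ≡ b
positionOf-colour α false = refl
positionOf-colour α true  = refl
positionOf-colour β false = refl
positionOf-colour β true  = refl
positionOf-colour γ false = refl
positionOf-colour γ true  = refl

layout : (Slot × Bool) ↔ Fin 6
layout = mk↔ₛ′ (λ (s , b) → colour s b) (λ c → slotOf c , positionOf c) colour-slotOf
               (λ (s , b) → cong₂ _,_ (slotOf-colour s b) (positionOf-colour s b))

slotPair : ∀ {P : Fin 6 → Set} s → (∀ b → P (colour s b)) → (∀ c → P c → slotOf c ≡ s) → Pair P
slotPair {P} s holds inSlot = record
  { pick      = colour s
  ; distinct  = λ e → false≢true (trans (sym (positionOf-colour s false))
                                       (trans (cong positionOf e) (positionOf-colour s true)))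
  ; satisfies = holds
  ; onto      = λ c Pc → positionOf c , trans (cong (λ s′ → colour s′ (positionOf c)) (sym (inSlot c Pc)))
                                              (colour-slotOf c)
  }
  where
  false≢true : false ≢ true
  false≢true ()

otherSlot : Slot → Bool → Slot
otherSlot α false = β
otherSlot α true  = γ
otherSlot β false = α
otherSlot β true  = γ
otherSlot γ false = α
otherSlot γ true  = β

otherSlot-onto : ∀ s₀ s → s ≢ s₀ → ∃ λ b → otherSlot s₀ b ≡ s
otherSlot-onto α α ne = ⊥-elim (ne refl)
otherSlot-onto α β _  = false , refl
otherSlot-onto α γ _  = true , refl
otherSlot-onto β α _  = false , refl
otherSlot-onto β β ne = ⊥-elim (ne refl)
otherSlot-onto β γ _  = true , refl
otherSlot-onto γ α _  = false , refl
otherSlot-onto γ β _  = true , refl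
otherSlot-onto γ γ ne = ⊥-elim (ne refl)

otherSlot-distinct : ∀ s₀ → otherSlot s₀ false ≢ otherSlot s₀ true
otherSlot-distinct α ()
otherSlot-distinct β ()
otherSlot-distinct γ ()

otherSlot-≢ : ∀ s₀ b → otherSlot s₀ b ≢ s₀
otherSlot-≢ α false ()
otherSlot-≢ α true  ()
otherSlot-≢ β false ()
otherSlot-≢ β true  ()
otherSlot-≢ γ false ()
otherSlot-≢ γ true  ()

offSlotsPair : ∀ {P : Fin 6 → Set} s₀ (chosen : Slot → Bool) →
  (∀ b → P (colour (otherSlot s₀ b) (chosen (otherSlot s₀ b)))) →
  (∀ c → P c → slotOf c ≢ s₀ × positionOf c ≡ chosen (slotOf c)) → Pair P
offSlotsPair {P} s₀ chosen holds only = record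
  { pick      = pick′
  ; distinct  = λ e → otherSlot-distinct s₀ (trans (sym (slotOf-colour _ _))
                                                  (trans (cong slotOf e) (slotOf-colour _ _)))
  ; satisfies = holds
  ; onto      = onto′
  }
  where
  pick′ : Bool → Fin 6
  pick′ b = colour (otherSlot s₀ b) (chosen (otherSlot s₀ b))
  onto′ : ∀ c → P c → ∃ λ b → pick′ b ≡ c
  onto′ c Pc with only c Pc
  ... | off , at with otherSlot-onto s₀ (slotOf c) off
  ...   | b , e = b , trans (cong (λ s → colour s (chosen s)) e)
                          (trans (cong (colour (slotOf c)) (sym at)) (colour-slotOf c))

-- A design says which colour of G_i each colour of the new graph restricts to.

record Design : Set where
  field
    place  : Slot ↔ Kind
    orient : Bool → Bool

  orientation : Kind → Bool
  orientation viaXY    = false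
  orientation (pair k) = orient k

  roleIn : (Slot × Bool) ↔ Role
  roleIn = mk↔ₛ′ to′ from′ to∘from from∘to
    where
    open Inverse place
    xor-cancel : ∀ a b → a xor (a xor b) ≡ b
    xor-cancel false b = refl
    xor-cancel true  b = not-involutive b
    to′ : Slot × Bool → Role
    to′ (s , b) = to s , orientation (to s) xor b
    from′ : Role → Slot × Bool
    from′ (k , b) = from k , orientation k xor b
    to∘from : ∀ r → to′ (from′ r) ≡ r
    to∘from (k , b) rewrite strictlyInverseˡ k = cong (k ,_) (xor-cancel (orientation k) b)
    from∘to : ∀ p → from′ (to′ p) ≡ p
    from∘to (s , b) rewrite strictlyInverseʳ s = cong (s ,_) (xor-cancel (orientation (to s)) b)

CyclicSucc : ∀ {n} → Fin (suc n) → Fin (suc n) → Set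
CyclicSucc {n} i j = suc (toℕ i) ≡ toℕ j ⊎ (suc (toℕ i) ≡ suc n × toℕ j ≡ 0)

next : ∀ {n} → Fin (suc n) → Fin (suc n)
next {n} i with suc (toℕ i) <? suc n
... | yes i+1<n+1 = fromℕ< i+1<n+1
... | no  _       = fzero

prev : ∀ {n} → Fin (suc n) → Fin (suc n)
prev {n} fzero    = fromℕ n
prev     (fsuc i) = inject₁ i

next-succ : ∀ {n} (i : Fin (suc n)) → CyclicSucc i (next i)
next-succ {n} i with suc (toℕ i) <? suc n
... | yes i+1<n+1 = inj₁ (sym (toℕ-fromℕ< i+1<n+1))
... | no  i+1≮n+1 =
  inj₂ (cong suc (ℕ.≤-antisym (ℕ.≤-pred (toℕ<n i)) (ℕ.≮⇒≥ (i+1≮n+1 ∘ s≤s))) , refl)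

prev-succ : ∀ {n} (i : Fin (suc n)) → CyclicSucc (prev i) i
prev-succ {n} fzero    = inj₂ (cong suc (toℕ-fromℕ n) , refl)
prev-succ     (fsuc i) = inj₁ (cong suc (toℕ-inject₁ i))

succ-functional : ∀ {n} {i j j′ : Fin (suc n)} → CyclicSucc i j → CyclicSucc i j′ → j ≡ j′
succ-functional (inj₁ e) (inj₁ e′) = toℕ-injective (trans (sym e) e′)
succ-functional {j = j} (inj₁ e) (inj₂ (e′ , _)) =
  ⊥-elim (ℕ.<-irrefl (trans (sym e) e′) (toℕ<n j))
succ-functional {j′ = j′} (inj₂ (e , _)) (inj₁ e′) =
  ⊥-elim (ℕ.<-irrefl (trans (sym e′) e) (toℕ<n j′))
succ-functional (inj₂ (_ , e)) (inj₂ (_ , e′)) = toℕ-injective (trans e (sym e′))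

succ-injective : ∀ {n} {i i′ j : Fin (suc n)} → CyclicSucc i j → CyclicSucc i′ j → i ≡ i′
succ-injective (inj₁ e) (inj₁ e′) = toℕ-injective (ℕ.suc-injective (trans e (sym e′)))
succ-injective (inj₁ e) (inj₂ (_ , e′)) with trans e e′
... | ()
succ-injective (inj₂ (_ , e)) (inj₁ e′) with trans e′ e
... | ()
succ-injective (inj₂ (e , _)) (inj₂ (e′ , _)) = toℕ-injective (ℕ.suc-injective (trans e (sym e′)))

succ-irreflexive : ∀ {n} (i : Fin (suc (suc n))) → ¬ CyclicSucc i i
succ-irreflexive i (inj₁ e) = ℕ.<-irrefl (sym e) (ℕ.n<1+n _)
succ-irreflexive i (inj₂ (e , e′)) with trans (sym (cong suc e′)) e
... | ()

next-prev : ∀ {n} (i : Fin (suc n)) → next (prev i) ≡ i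
next-prev i = succ-functional (next-succ (prev i)) (prev-succ i)

prev-next : ∀ {n} (i : Fin (suc n)) → prev (next i) ≡ i
prev-next i = succ-injective (prev-succ (next i)) (next-succ i)

next≢ : ∀ {n} (i : Fin (suc (suc n))) → i ≢ next i
next≢ i e = succ-irreflexive i (subst (CyclicSucc i) (sym e) (next-succ i))

isEven : ℕ → Bool
isEven 0             = true
isEven 1             = false
isEven (suc (suc n)) = isEven n

isEven-suc : ∀ n → isEven (suc n) ≡ not (isEven n)
isEven-suc 0             = refl
isEven-suc 1             = refl
isEven-suc (suc (suc n)) = isEven-suc n

isEven-double : ∀ m → isEven (m + m) ≡ true
isEven-double 0       = refl
isEven-double (suc m) = trans (cong isEven (cong suc (ℕ.+-suc m m))) (isEven-double m)

pairUp : ℕ → ℕ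
pairUp 0             = 1
pairUp 1             = 0
pairUp (suc (suc n)) = suc (suc (pairUp n))

pairUp-involutive : ∀ n → pairUp (pairUp n) ≡ n
pairUp-involutive 0             = refl
pairUp-involutive 1             = refl
pairUp-involutive (suc (suc n)) = cong (suc ∘ suc) (pairUp-involutive n)

pairUp-step : ∀ n → pairUp n ≡ suc n ⊎ suc (pairUp n) ≡ n
pairUp-step 0             = inj₁ refl
pairUp-step 1             = inj₂ refl
pairUp-step (suc (suc n)) = Sum.map (cong (suc ∘ suc)) (cong (suc ∘ suc)) (pairUp-step n)

pairUp-even : ∀ m → pairUp (m + m) ≡ suc (m + m)
pairUp-even 0       = refl
pairUp-even (suc m) rewrite ℕ.+-suc m m = cong (suc ∘ suc) (pairUp-even m)

pairUp-odd : ∀ m → pairUp (suc (m + m)) ≡ m + m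
pairUp-odd 0       = refl
pairUp-odd (suc m) rewrite ℕ.+-suc m m = cong (suc ∘ suc) (pairUp-odd m)

pairUp-< : ∀ m n → n < m + m → pairUp n < m + m
pairUp-< (suc m) 0             _ = s≤s (subst (1 ≤_) (sym (ℕ.+-suc m m)) (s≤s z≤n))
pairUp-< (suc m) 1             _ = s≤s z≤n
pairUp-< (suc m) (suc (suc n)) (s≤s n+1<2m+2)
  rewrite ℕ.+-suc m m = s≤s (s≤s (pairUp-< m n (ℕ.≤-pred n+1<2m+2)))

-- Junctions: how a colour of the new graph behaves at the gadget a_i b_i c_i
-- lying between H_i and H_{i+1}.  The y-end of G_i and the x-end of G_{i+1}
-- are attached to a_i (end false) or b_i (end true).  Either both are used
-- and c_i is matched along the spine, or one of G_i, G_{i+1} uses its edge xy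
-- and c_i is matched to whichever of a_i, b_i is left free.

data Junction : Set where
  through left right : Bool → Junction

shift : Junction → Bool → Junction
shift (through e) b = through (e xor b)
shift (left e)    b = left (e xor b)
shift (right e)   b = right (e xor b)

leftEnd rightEnd : Junction → Maybe Bool
leftEnd (through e) = just e
leftEnd (left e)    = just e
leftEnd (right _)   = nothing
rightEnd (through e) = just (not e)
rightEnd (left _)    = nothing
rightEnd (right e)   = just e

data Side : Junction → Set where
  leftSide  : ∀ e → Side (left e)
  rightSide : ∀ e → Side (right e)

through-¬side : ∀ {J e} → J ≡ through e → ¬ Side J
through-¬side refl ()

base : Junction → Bool
base (through e) = e
base (left e)    = e
base (right e)   = e

Describes : (Bool → EndState) → (Bool → EndState) → Junction → Set
Describes here there J =
  ∀ b → yEnd (here b) ≡ leftEnd (shift J b) × xEnd (there b) ≡ rightEnd (shift J b)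

private
  xor-swap : ∀ o b t → (o xor b) xor t ≡ (o xor t) xor b
  xor-swap o b t = trans (xor-assoc o b t) (trans (cong (o xor_) (xor-comm b t)) (sym (xor-assoc o t b)))

left-describes : ∀ tw k o →
  Describes (λ b → roleState tw (pair k , o xor b)) (λ _ → usesXY) (left (o xor tw k))
left-describes tw k o b = cong just (xor-swap o b (tw k)) , refl

right-describes : ∀ tw k o →
  Describes (λ _ → usesXY) (λ b → roleState tw (pair k , o xor b)) (right o)
right-describes tw k o b = refl , refl

through-describes : ∀ tw k o tw′ k′ o′ → o′ ≡ not (o xor tw k) →
  Describes (λ b → roleState tw (pair k , o xor b)) (λ b → roleState tw′ (pair k′ , o′ xor b))
            (through (o xor tw k))
through-describes tw k o tw′ k′ o′ refl b =
  cong just (xor-swap o b (tw k)) , cong just (sym (not-distribˡ-xor (o xor tw k) b))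

place₀ place₁ placeEven placeOdd : Slot ↔ Kind
place₀ = mk↔ₛ′ (λ { α → pair false ; β → viaXY ; γ → pair true })
               (λ { viaXY → β ; (pair false) → α ; (pair true) → γ })
               (λ { viaXY → refl ; (pair false) → refl ; (pair true) → refl })
               (λ { α → refl ; β → refl ; γ → refl })
place₁ = mk↔ₛ′ (λ { α → pair false ; β → pair true ; γ → viaXY })
               (λ { viaXY → γ ; (pair false) → α ; (pair true) → β })
               (λ { viaXY → refl ; (pair false) → refl ; (pair true) → refl })
               (λ { α → refl ; β → refl ; γ → refl })
placeEven = mk↔ₛ′ (λ { α → pair true ; β → viaXY ; γ → pair false })
                  (λ { viaXY → β ; (pair false) → γ ; (pair true) → α })
                  (λ { viaXY → refl ; (pair false) → refl ; (pair true) → refl })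
                  (λ { α → refl ; β → refl ; γ → refl })
placeOdd = mk↔ₛ′ (λ { α → viaXY ; β → pair true ; γ → pair false })
                 (λ { viaXY → α ; (pair false) → γ ; (pair true) → β })
                 (λ { viaXY → refl ; (pair false) → refl ; (pair true) → refl })
                 (λ { α → refl ; β → refl ; γ → refl })

-- The slot whose colours match c_i along the spine c_1 v_0 v_1 … v_{k-3} c_0.
spineSlot : ℕ → Slot
spineSlot 0             = α
spineSlot 1             = α
spineSlot (suc (suc _)) = γ

module Cover (h : ℕ) (D : MData (suc (suc (suc (suc (h + h)))))) where

  K : ℕ
  K = suc (suc (suc (suc (h + h))))

  open MData D
  open Construction K n G x y x0 x1 y0 y1

  Mᵢ : (i : Fin K) → Fin 6 → Fin (n i) → Fin (n i) → Set
  Mᵢ i = proj₁ (fulkerson i)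

  module Local (i : Fin K) where
    open AtEdge (cubic i) (Mᵢ i) (proj₁ (proj₂ (fulkerson i))) (proj₂ (proj₂ (fulkerson i)))
      (xy i) (subst T (adj-sym (G i) (x i) (y i)) (xy i)) (xx0 i) (xx1 i) (yy0 i) (yy1 i)
      (x0≢x1 i) (x0≢y i) (x1≢y i) (y0≢y1 i) (y0≢x i) (y1≢x i) public
    open EdgeColouring edgeColouring public

  twist : Fin K → Bool → Bool
  twist i = Local.twist i

  twistAt : ℕ → Bool → Bool
  twistAt t with t <? K
  ... | yes t<K = twist (fromℕ< t<K)
  ... | no  _   = λ _ → false

  twistAt-toℕ : ∀ i → twistAt (toℕ i) false ≡ twist i false
  twistAt-toℕ i with toℕ i <? K
  ... | yes i<K = cong (λ j → twist j false) (fromℕ<-toℕ i i<K)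
  ... | no  i≮K = ⊥-elim (i≮K (toℕ<n i))

  -- The orientations along the two spine chains: γ through G_2, …, G_{k-1}, G_0
  -- and α through G_0, G_1, G_2; each solves the recurrence of through-describes.
  γOrient : ℕ → Bool
  γOrient 0       = false
  γOrient (suc m) = not (γOrient m xor twistAt (suc (suc m)) false)

  αOrient₁ αOrient₂ : Bool
  αOrient₁ = not (twistAt 0 false)
  αOrient₂ = not (αOrient₁ xor twistAt 1 false)

  laterDesign : Bool → Bool → Design
  laterDesign true  o = record { place = placeOdd  ; orient = λ { false → o ; true → false } }
  laterDesign false o = record { place = placeEven ; orient = λ { false → o ; true → false } }

  designAt : ℕ → Design
  designAt 0 = record { place = place₀ ; orient = λ { false → false ; true → γOrient (suc (suc (h + h))) } }
  designAt 1 = record { place = place₁ ; orient = λ { false → αOrient₁ ; true → false } }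
  designAt 2 = record { place = placeEven ; orient = λ { false → γOrient 0 ; true → αOrient₂ } }
  designAt (suc (suc (suc m))) = laterDesign (isEven m) (γOrient (suc m))

  stateFor : Design → (Bool → Bool) → Slot → Bool → EndState
  stateFor d tw s b = roleState tw (Inverse.to (Design.roleIn d) (s , b))

  record Link (d d′ : Design) (tw tw′ : Bool → Bool) (s₀ s : Slot) : Set where
    field
      junction      : Junction
      describes     : Describes (stateFor d tw s) (stateFor d′ tw′ s) junction
      spine⇒through : s ≡ s₀ → ∃ λ e → junction ≡ through e
      through⇒spine : ∀ {e} → junction ≡ through e → s ≡ s₀

  module _ {d d′ : Design} {tw tw′ : Bool → Bool} {s₀ s : Slot} where

    throughLink : ∀ k o → s ≡ s₀ →
                  Describes (stateFor d tw s) (stateFor d′ tw′ s) (through (o xor tw k)) →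
                  Link d d′ tw tw′ s₀ s
    throughLink k o onSpine describes = record
      { junction = through (o xor tw k) ; describes = describes
      ; spine⇒through = λ _ → _ , refl ; through⇒spine = λ _ → onSpine }

    leftLink : ∀ k o → s ≢ s₀ →
               Describes (stateFor d tw s) (stateFor d′ tw′ s) (left (o xor tw k)) →
               Link d d′ tw tw′ s₀ s
    leftLink k o offSpine describes = record
      { junction = left (o xor tw k) ; describes = describes
      ; spine⇒through = ⊥-elim ∘ offSpine ; through⇒spine = λ () }

    rightLink : ∀ o → s ≢ s₀ →
                Describes (stateFor d tw s) (stateFor d′ tw′ s) (right o) →
                Link d d′ tw tw′ s₀ s
    rightLink o offSpine describes = record
      { junction = right o ; describes = describes
      ; spine⇒through = ⊥-elim ∘ offSpine ; through⇒spine = λ () }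

  LinkAt : ℕ → ℕ → (Bool → Bool) → (Bool → Bool) → Slot → Set
  LinkAt t t′ tw tw′ = Link (designAt t) (designAt t′) tw tw′ (spineSlot t)

  module _ {tw tw′ : Bool → Bool} where

    link₀ : twistAt 0 false ≡ tw false → ∀ s → LinkAt 0 1 tw tw′ s
    link₀ e α = throughLink false false refl (through-describes tw false false tw′ false αOrient₁ (cong not e))
    link₀ e β = rightLink false (λ ()) (right-describes tw′ true false)
    link₀ e γ = leftLink true o (λ ()) (left-describes tw true o)
      where o = γOrient (suc (suc (h + h)))

    link₁ : twistAt 1 false ≡ tw false → ∀ s → LinkAt 1 2 tw tw′ s
    link₁ e α = throughLink false αOrient₁ refl
                  (through-describes tw false αOrient₁ tw′ true αOrient₂
                     (cong (λ d → not (αOrient₁ xor d)) e))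
    link₁ e β = leftLink true false (λ ()) (left-describes tw true false)
    link₁ e γ = rightLink (γOrient 0) (λ ()) (right-describes tw′ false (γOrient 0))

    link₂ : twistAt 2 false ≡ tw false → ∀ s → LinkAt 2 3 tw tw′ s
    link₂ e α = leftLink true αOrient₂ (λ ()) (left-describes tw true αOrient₂)
    link₂ e β = rightLink false (λ ()) (right-describes tw′ true false)
    link₂ e γ = throughLink false (γOrient 0) refl
                  (through-describes tw false (γOrient 0) tw′ false (γOrient 1)
                     (cong (λ d → not (γOrient 0 xor d)) e))

    linkLater : ∀ p p′ o o′ → p′ ≡ not p → o′ ≡ not (o xor tw false) →
                ∀ s → Link (laterDesign p o) (laterDesign p′ o′) tw tw′ γ s
    linkLater true  .false o o′ refl e α = rightLink false (λ ()) (right-describes tw′ true false)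
    linkLater true  .false o o′ refl e β = leftLink true false (λ ()) (left-describes tw true false)
    linkLater false .true  o o′ refl e α = leftLink true false (λ ()) (left-describes tw true false)
    linkLater false .true  o o′ refl e β = rightLink false (λ ()) (right-describes tw′ true false)
    linkLater true  .false o o′ refl e γ = throughLink false o refl (through-describes tw false o tw′ false o′ e)
    linkLater false .true  o o′ refl e γ = throughLink false o refl (through-describes tw false o tw′ false o′ e)

    linkLast : ∀ p → p ≡ true → twistAt (3 + (h + h)) false ≡ tw false →
               ∀ s → Link (laterDesign p (γOrient (suc (h + h)))) (designAt 0) tw tw′ γ s
    linkLast .true refl e α = rightLink false (λ ()) (right-describes tw′ false false)
    linkLast .true refl e β = leftLink true false (λ ()) (left-describes tw true false)
    linkLast .true refl e γ = throughLink false o refl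
      (through-describes tw false o tw′ true (γOrient (suc (suc (h + h)))) (cong (λ d → not (o xor d)) e))
      where o = γOrient (suc (h + h))

  linkStep : ∀ t {tw tw′} → twistAt t false ≡ tw false → ∀ s → LinkAt t (suc t) tw tw′ s
  linkStep 0                   = link₀
  linkStep 1                   = link₁
  linkStep 2                   = link₂
  linkStep (suc (suc (suc m))) e =
    linkLater (isEven m) (isEven (suc m)) _ _ (isEven-suc m) (cong (λ d → not (γOrient (suc m) xor d)) e)

  link : ∀ i s → LinkAt (toℕ i) (toℕ (next i)) (twist i) (twist (next i)) s
  link i s with next-succ i
  ... | inj₁ e = subst (λ t′ → LinkAt (toℕ i) t′ (twist i) (twist (next i)) s) e
                       (linkStep (toℕ i) (twistAt-toℕ i) s)
  ... | inj₂ (e , e′) = subst₂ (λ t t′ → LinkAt t t′ (twist i) (twist (next i)) s)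
                               (sym (ℕ.suc-injective e)) (sym e′)
                               (linkLast (isEven (h + h)) (isEven-double h)
                                  (trans (cong (λ t → twistAt t false) (sym (ℕ.suc-injective e))) (twistAt-toℕ i)) s)

  -- The colour of G_i playing the part of colour c of the new graph.
  π : Fin K → Fin 6 ↔ Fin 6
  π i = Local.role i ↔-∘ (Design.roleIn (designAt (toℕ i)) ↔-∘ ↔-sym layout)

  colourIn : Fin K → Fin 6 → Fin 6
  colourIn i = Inverse.to (π i)

  stateAt : Fin K → Fin 6 → EndState
  stateAt i c = stateFor (designAt (toℕ i)) (twist i) (slotOf c) (positionOf c)

  realises : ∀ i c → Local.Realises i (colourIn i c) (stateAt i c)
  realises i c = Local.realises i (Inverse.to (Design.roleIn (designAt (toℕ i))) (slotOf c , positionOf c))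

  junctionAt : Fin K → Fin 6 → Junction
  junctionAt i c = shift (Link.junction (link i (slotOf c))) (positionOf c)

  yEnd-junction : ∀ i c → yEnd (stateAt i c) ≡ leftEnd (junctionAt i c)
  yEnd-junction i c = proj₁ (Link.describes (link i (slotOf c)) (positionOf c))

  xEnd-junction : ∀ i c → xEnd (stateAt (next i) c) ≡ rightEnd (junctionAt i c)
  xEnd-junction i c = proj₂ (Link.describes (link i (slotOf c)) (positionOf c))

  module PMᵢ (i : Fin K) (j : Fin 6) = PerfectMatching (proj₁ (proj₂ (fulkerson i)) j)

  partnerIn : (i : Fin K) → Fin 6 → Fin (n i) → Fin (n i)
  partnerIn i c = PMᵢ.partner i (colourIn i c)

  adj-≢ : ∀ i {u v} → T (adj (G i) u v) → u ≢ v
  adj-≢ i {u} u~u refl = subst T (adj-irrefl (G i) u) u~u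

  x~xs : ∀ i s → T (adj (G i) (x i) (Local.xs i s))
  x~xs i false = xx0 i
  x~xs i true  = xx1 i

  y~ys : ∀ i t → T (adj (G i) (y i) (Local.ys i t))
  y~ys i false = yy0 i
  y~ys i true  = yy1 i

  hX hY : Fin K → Bool → Vtx
  hX i s = hv i (Local.xs i s) (adj-≢ i (x~xs i s) ∘ sym) (Local.xs≢y i s)
  hY i t = hv i (Local.ys i t) (Local.ys≢x i t) (adj-≢ i (y~ys i t) ∘ sym)

  -- a_i is joined to y_0 of H_i and x_0 of H_{i+1}, b_i to y_1 and x_1
  ab : Fin K → Bool → Vtx
  ab i false = av i
  ab i true  = bv i

  k-2 : ℕ
  k-2 = suc (suc (h + h))

  -- the spine c_1 v_0 v_1 … v_{k-3} c_0, by position 0, …, k-1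
  spineAt : ℕ → Vtx
  spineAt 0 = cv 1F
  spineAt (suc m) with m <? k-2
  ... | yes m<k-2 = vv (fromℕ< m<k-2)
  ... | no  _     = cv 0F

  cAt : ℕ → Vtx
  cAt m with m <? K
  ... | yes m<K = cv (fromℕ< m<K)
  ... | no  _   = cv 0F

  hMate : (i : Fin K) → Fin (n i) → Fin (n i) → Vtx
  hMate i u w with w ≟ x i | w ≟ y i
  ... | yes _  | _      = ab (prev i) (not (does (u ≟ x0 i)))
  ... | no  _  | yes _  = ab i (not (does (u ≟ y0 i)))
  ... | no w≢x | no w≢y = hv i w w≢x w≢y

  abMate : Fin K → Bool → Junction → Vtx
  abMate i b (through e) = if b xor e then hX (next i) b else hY i b
  abMate i b (left e)    = if b xor e then cv i else hY i b
  abMate i b (right e)   = if b xor e then cv i else hX (next i) b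

  spineMate : ℕ → Vtx
  spineMate 0             = spineAt k-2
  spineMate 1             = spineAt 1
  spineMate (suc (suc m)) = spineAt (suc m)

  cMate : Fin K → Junction → Vtx
  cMate i (through _) = spineMate (toℕ i)
  cMate i (left e)    = ab i (not e)
  cMate i (right e)   = ab i (not e)

  vMate : Slot → ℕ → Vtx
  vMate α m = spineAt (pairUp (suc m))
  vMate β m = spineAt (suc (pairUp m))
  vMate γ m = cAt (suc (suc m))

  mate : Fin 6 → Vtx → Vtx
  mate c (hv i u _ _) = hMate i u (partnerIn i c u)
  mate c (av i)       = abMate i false (junctionAt i c)
  mate c (bv i)       = abMate i true (junctionAt i c)
  mate c (cv i)       = cMate i (junctionAt i c)
  mate c (vv j)       = vMate (slotOf c) (toℕ j)

  spineAt-< : ∀ m (m<k-2 : m < k-2) → spineAt (suc m) ≡ vv (fromℕ< m<k-2)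
  spineAt-< m m<k-2 with m <? k-2
  ... | yes _     = refl
  ... | no  m≮k-2 = ⊥-elim (m≮k-2 m<k-2)

  spineAt-vv : ∀ j → spineAt (suc (toℕ j)) ≡ vv j
  spineAt-vv j = trans (spineAt-< (toℕ j) (toℕ<n j)) (cong vv (fromℕ<-toℕ j (toℕ<n j)))

  spineAt-c₀ : spineAt (suc k-2) ≡ cv 0F
  spineAt-c₀ with k-2 <? k-2
  ... | yes k-2<k-2 = ⊥-elim (ℕ.<-irrefl refl k-2<k-2)
  ... | no  _       = refl

  cAt-< : ∀ m (m<K : m < K) → cAt m ≡ cv (fromℕ< m<K)
  cAt-< m m<K with m <? K
  ... | yes _   = refl
  ... | no  m≮K = ⊥-elim (m≮K m<K)

  spine-edge : ∀ q → suc q < K → E (spineAt (suc q)) (spineAt q)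
  spine-edge 0       _ = subst (λ v → E v (cv 1F)) (sym (spineAt-< 0 (s≤s z≤n))) (eVC1 _ 1F refl refl)
  spine-edge (suc m) (s≤s q+1<K) with suc m <? k-2
  ... | yes m+1<k-2 = subst (E (vv (fromℕ< m+1<k-2))) (sym (spineAt-< m m<k-2))
                        (eVV _ _ (trans (toℕ-fromℕ< m+1<k-2) (cong suc (sym (toℕ-fromℕ< m<k-2)))))
    where m<k-2 = ℕ.<-trans (ℕ.n<1+n m) m+1<k-2
  ... | no  m+1≮k-2 = subst (E (cv 0F)) (sym (spineAt-< m m<k-2))
                        (eC0V 0F _ refl (cong (suc ∘ suc ∘ suc) (trans (toℕ-fromℕ< m<k-2) m≡k-3)))
    where
    m+1≡k-2 = ℕ.≤-antisym (ℕ.≤-pred q+1<K) (ℕ.≮⇒≥ m+1≮k-2)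
    m≡k-3 = ℕ.suc-injective m+1≡k-2
    m<k-2 = subst (_≤ k-2) (sym m+1≡k-2) ℕ.≤-refl

  j<k-2⇒j+1<K : ∀ {m} → m < k-2 → suc m < K
  j<k-2⇒j+1<K m<k-2 = s≤s (ℕ.<-trans m<k-2 (ℕ.n<1+n _))

  pairUp-<K : ∀ p → p < K → pairUp p < K
  pairUp-<K p p<K = subst (pairUp p <_) (sym K≡) (pairUp-< (suc (suc h)) p (subst (p <_) K≡ p<K))
    where
    K≡ : K ≡ suc (suc h) + suc (suc h)
    K≡ = cong (suc ∘ suc) (sym (trans (ℕ.+-suc h (suc h)) (cong suc (ℕ.+-suc h h))))

  pairUp-<k-2 : ∀ m → m < k-2 → pairUp m < k-2
  pairUp-<k-2 m m<k-2 = subst (pairUp m <_) (sym k-2≡) (pairUp-< (suc h) m (subst (m <_) k-2≡ m<k-2))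
    where
    k-2≡ : k-2 ≡ suc h + suc h
    k-2≡ = cong suc (sym (ℕ.+-suc h h))

  spine-step : ∀ p q → p < K → q < K → p ≡ suc q ⊎ q ≡ suc p → Adj Γ (spineAt p) (spineAt q)
  spine-step .(suc q) q p<K _ (inj₁ refl) = inj₁ (spine-edge q p<K)
  spine-step p .(suc p) _ q<K (inj₂ refl) = inj₂ (spine-edge p q<K)

  pairUp-neighbour : ∀ p → p ≡ suc (pairUp p) ⊎ pairUp p ≡ suc p
  pairUp-neighbour p = Sum.swap (Sum.map₂ sym (pairUp-step p))

  adjacent-ab : ∀ i b J → Adj Γ (ab i b) (abMate i b J)
  adjacent-ab i false (through false) = inj₁ (eAY i _ _)
  adjacent-ab i false (through true)  = inj₁ (eAX i (next i) (next-succ i) _ _)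
  adjacent-ab i true  (through false) = inj₁ (eBX i (next i) (next-succ i) _ _)
  adjacent-ab i true  (through true)  = inj₁ (eBY i _ _)
  adjacent-ab i false (left false)    = inj₁ (eAY i _ _)
  adjacent-ab i false (left true)     = inj₁ (eAC i)
  adjacent-ab i true  (left false)    = inj₁ (eBC i)
  adjacent-ab i true  (left true)     = inj₁ (eBY i _ _)
  adjacent-ab i false (right false)   = inj₁ (eAX i (next i) (next-succ i) _ _)
  adjacent-ab i false (right true)    = inj₁ (eAC i)
  adjacent-ab i true  (right false)   = inj₁ (eBC i)
  adjacent-ab i true  (right true)    = inj₁ (eBX i (next i) (next-succ i) _ _)

  adjacent-spine : ∀ i t → toℕ i ≡ t → Adj Γ (cv i) (spineMate t)
  adjacent-spine i 0 e = inj₁ (subst (E (cv i)) (sym (spineAt-< (suc (h + h)) ℕ.≤-refl))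
                                 (eC0V i _ e (cong (suc ∘ suc ∘ suc) (toℕ-fromℕ< ℕ.≤-refl))))
  adjacent-spine i 1 e = inj₂ (subst (λ v → E v (cv i)) (sym (spineAt-< 0 (s≤s z≤n))) (eVC1 _ i refl e))
  adjacent-spine i (suc (suc m)) e = inj₁ (subst (E (cv i)) (sym (spineAt-< m m<k-2))
                                       (eCV i _ (trans e (cong (suc ∘ suc) (sym (toℕ-fromℕ< m<k-2))))))
    where m<k-2 = ℕ.≤-pred (ℕ.≤-pred (subst (_< K) e (toℕ<n i)))

  adjacent-c-ab : ∀ i b → Adj Γ (cv i) (ab i b)
  adjacent-c-ab i false = inj₂ (eAC i)
  adjacent-c-ab i true  = inj₂ (eBC i)

  adjacent-c : ∀ i J → Adj Γ (cv i) (cMate i J)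
  adjacent-c i (through _) = adjacent-spine i (toℕ i) refl
  adjacent-c i (left e)    = adjacent-c-ab i (not e)
  adjacent-c i (right e)   = adjacent-c-ab i (not e)

  adjacent-v : ∀ s j → Adj Γ (vv j) (vMate s (toℕ j))
  adjacent-v α j = subst (λ v → Adj Γ v (vMate α (toℕ j))) (spineAt-vv j)
    (spine-step _ _ m+1<K (pairUp-<K _ m+1<K) (pairUp-neighbour (suc (toℕ j))))
    where m+1<K = j<k-2⇒j+1<K (toℕ<n j)
  adjacent-v β j = subst (λ v → Adj Γ v (vMate β (toℕ j))) (spineAt-vv j)
    (spine-step _ _ (j<k-2⇒j+1<K (toℕ<n j)) (j<k-2⇒j+1<K (pairUp-<k-2 _ (toℕ<n j)))
                (Sum.map (cong suc) (cong suc) (pairUp-neighbour (toℕ j))))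
  adjacent-v γ j = inj₂ (subst (λ v → E v (vv j)) (sym (cAt-< _ j+2<K)) (eCV _ j (toℕ-fromℕ< j+2<K)))
    where j+2<K = s≤s (s≤s (toℕ<n j))

  adj-symm : ∀ i {u v} → T (adj (G i) u v) → T (adj (G i) v u)
  adj-symm i {u} {v} = subst T (adj-sym (G i) u v)

  x-neighbour : ∀ i {u} → T (adj (G i) (x i) u) → u ≡ y i ⊎ u ≡ x0 i ⊎ u ≡ x1 i
  x-neighbour i = cubic-neighbours (cubic i) (xy i) (xx0 i) (xx1 i)
                    (x0≢y i ∘ sym) (x1≢y i ∘ sym) (x0≢x1 i)

  y-neighbour : ∀ i {u} → T (adj (G i) (y i) u) → u ≡ x i ⊎ u ≡ y0 i ⊎ u ≡ y1 i
  y-neighbour i = cubic-neighbours (cubic i) (adj-symm i (xy i)) (yy0 i) (yy1 i)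
                    (y0≢x i ∘ sym) (y1≢x i ∘ sym) (y0≢y1 i)

  adjacent-h : ∀ i {j} u .(ux : u ≢ x i) .(uy : u ≢ y i) w → Mᵢ i j u w →
               Adj Γ (hv i u ux uy) (hMate i u w)
  adjacent-h i {j} u ux uy w u~w with w ≟ x i | w ≟ y i
  ... | yes refl | _ with u ≟ x0 i
  ...   | yes refl = inj₂ (eAX (prev i) i (prev-succ i) _ _)
  ...   | no u≢x0 with x-neighbour i (adj-symm i (PMᵢ.matched-adj i j u~w))
  ...     | inj₁ u≡y          = Irrelevant.⊥-elim (uy u≡y)
  ...     | inj₂ (inj₁ u≡x0) = ⊥-elim (u≢x0 u≡x0)
  ...     | inj₂ (inj₂ refl)  = inj₂ (eBX (prev i) i (prev-succ i) _ _)
  adjacent-h i {j} u ux uy w u~w | no _ | yes refl with u ≟ y0 i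
  ...   | yes refl = inj₂ (eAY i _ _)
  ...   | no u≢y0 with y-neighbour i (adj-symm i (PMᵢ.matched-adj i j u~w))
  ...     | inj₁ u≡x          = Irrelevant.⊥-elim (ux u≡x)
  ...     | inj₂ (inj₁ u≡y0) = ⊥-elim (u≢y0 u≡y0)
  ...     | inj₂ (inj₂ refl)  = inj₂ (eBY i _ _)
  adjacent-h i {j} u ux uy w u~w | no w≢x | no w≢y = inj₁ (eH i u w ux uy w≢x w≢y (PMᵢ.matched-adj i j u~w))

  adjacent : ∀ c v → Adj Γ v (mate c v)
  adjacent c (hv i u ux uy) = adjacent-h i u ux uy _ (PMᵢ.partner-matched i (colourIn i c) u)
  adjacent c (av i)         = adjacent-ab i false (junctionAt i c)
  adjacent c (bv i)         = adjacent-ab i true (junctionAt i c)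
  adjacent c (cv i)         = adjacent-c i (junctionAt i c)
  adjacent c (vv j)         = adjacent-v (slotOf c) j

  leftEnd-matched : ∀ i c {t} → leftEnd (junctionAt i c) ≡ just t → Mᵢ i (colourIn i c) (y i) (Local.ys i t)
  leftEnd-matched i c e = Local.yEnd-realised i (realises i c) (trans (yEnd-junction i c) e)

  matched-leftEnd : ∀ i c {t} → Mᵢ i (colourIn i c) (y i) (Local.ys i t) → leftEnd (junctionAt i c) ≡ just t
  matched-leftEnd i c m = trans (sym (yEnd-junction i c)) (Local.realises-yEnd i (realises i c) m)

  rightEnd-matched : ∀ i c {s} → rightEnd (junctionAt i c) ≡ just s →
                     Mᵢ (next i) (colourIn (next i) c) (x (next i)) (Local.xs (next i) s)
  rightEnd-matched i c e = Local.xEnd-realised (next i) (realises (next i) c) (trans (xEnd-junction i c) e)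

  matched-rightEnd : ∀ i c {s} → Mᵢ i (colourIn i c) (x i) (Local.xs i s) →
                     rightEnd (junctionAt (prev i) c) ≡ just s
  matched-rightEnd i c {s} m =
    trans (sym (xEnd-junction (prev i) c))
          (subst (λ i′ → xEnd (stateAt i′ c) ≡ just s) (sym (next-prev i)) (Local.realises-xEnd i (realises i c) m))

  abMate-leftEnd : ∀ i b J → leftEnd J ≡ just b → abMate i b J ≡ hY i b
  abMate-leftEnd i false (through .false) refl = refl
  abMate-leftEnd i true  (through .true)  refl = refl
  abMate-leftEnd i false (left .false)    refl = refl
  abMate-leftEnd i true  (left .true)     refl = refl

  abMate-rightEnd : ∀ i b J → rightEnd J ≡ just b → abMate i b J ≡ hX (next i) b
  abMate-rightEnd i false (through true)  refl = refl
  abMate-rightEnd i true  (through false) refl = refl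
  abMate-rightEnd i false (right .false)  refl = refl
  abMate-rightEnd i true  (right .true)   refl = refl

  data ABMate (i : Fin K) (b : Bool) (J : Junction) : Set where
    matesY : leftEnd J ≡ just b → ABMate i b J
    matesX : rightEnd J ≡ just b → ABMate i b J
    matesC : cMate i J ≡ ab i b → abMate i b J ≡ cv i → ABMate i b J

  abMate-cases : ∀ i b J → ABMate i b J
  abMate-cases i false (through false) = matesY refl
  abMate-cases i true  (through true)  = matesY refl
  abMate-cases i false (through true)  = matesX refl
  abMate-cases i true  (through false) = matesX refl
  abMate-cases i false (left false)    = matesY refl
  abMate-cases i true  (left true)     = matesY refl
  abMate-cases i false (left true)     = matesC refl refl
  abMate-cases i true  (left false)    = matesC refl refl
  abMate-cases i false (right false)   = matesX refl
  abMate-cases i true  (right true)    = matesX refl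
  abMate-cases i false (right true)    = matesC refl refl
  abMate-cases i true  (right false)   = matesC refl refl

  hMate-x : ∀ i s → hMate i (Local.xs i s) (x i) ≡ ab (prev i) s
  hMate-x i s with x i ≟ x i
  ... | no x≢x = ⊥-elim (x≢x refl)
  ... | yes _ with s | Local.xs i s ≟ x0 i
  ...   | false | yes _    = refl
  ...   | false | no x0≢x0 = ⊥-elim (x0≢x0 refl)
  ...   | true  | yes x1≡x0 = ⊥-elim (x0≢x1 i (sym x1≡x0))
  ...   | true  | no _     = refl

  hMate-y : ∀ i t → hMate i (Local.ys i t) (y i) ≡ ab i t
  hMate-y i t with y i ≟ x i | y i ≟ y i
  ... | yes y≡x | _     = ⊥-elim (adj-≢ i (xy i) (sym y≡x))
  ... | no _    | no y≢y = ⊥-elim (y≢y refl)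
  ... | no _    | yes _ with t | Local.ys i t ≟ y0 i
  ...   | false | yes _     = refl
  ...   | false | no y0≢y0  = ⊥-elim (y0≢y0 refl)
  ...   | true  | yes y1≡y0 = ⊥-elim (y0≢y1 i (sym y1≡y0))
  ...   | true  | no _      = refl

  hMate-inner : ∀ i u w .(wx : w ≢ x i) .(wy : w ≢ y i) → hMate i u w ≡ hv i w wx wy
  hMate-inner i u w wx wy with w ≟ x i | w ≟ y i
  ... | yes w≡x | _       = Irrelevant.⊥-elim (wx w≡x)
  ... | no _    | yes w≡y = Irrelevant.⊥-elim (wy w≡y)
  ... | no _    | no _    = refl

  partnerIn-matched : ∀ i c {u w} → Mᵢ i (colourIn i c) u w → partnerIn i c u ≡ w
  partnerIn-matched i c m = sym (PMᵢ.matched⇒partner i (colourIn i c) m)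

  mate-hY : ∀ c i t → leftEnd (junctionAt i c) ≡ just t → mate c (hY i t) ≡ ab i t
  mate-hY c i t e = trans (cong (hMate i (Local.ys i t))
                                (partnerIn-matched i c (PMᵢ.matched-sym i _ (leftEnd-matched i c e))))
                          (hMate-y i t)

  mate-hX : ∀ c i s → rightEnd (junctionAt i c) ≡ just s → mate c (hX (next i) s) ≡ ab i s
  mate-hX c i s e = begin
    hMate (next i) (Local.xs (next i) s) (partnerIn (next i) c (Local.xs (next i) s))
      ≡⟨ cong (hMate (next i) (Local.xs (next i) s))
              (partnerIn-matched (next i) c (PMᵢ.matched-sym (next i) _ (rightEnd-matched i c e))) ⟩
    hMate (next i) (Local.xs (next i) s) (x (next i))   ≡⟨ hMate-x (next i) s ⟩
    ab (prev (next i)) s                                 ≡⟨ cong (λ i′ → ab i′ s) (prev-next i) ⟩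
    ab i s                                               ∎

  mate-ab : ∀ c i b → mate c (ab i b) ≡ abMate i b (junctionAt i c)
  mate-ab c i false = refl
  mate-ab c i true  = refl

  involutive-ab : ∀ c i b → mate c (mate c (ab i b)) ≡ ab i b
  involutive-ab c i b with abMate-cases i b (junctionAt i c)
  ... | matesY e = trans (cong (mate c) (trans (mate-ab c i b) (abMate-leftEnd i b _ e))) (mate-hY c i b e)
  ... | matesX e = trans (cong (mate c) (trans (mate-ab c i b) (abMate-rightEnd i b _ e))) (mate-hX c i b e)
  ... | matesC e e′ = trans (cong (mate c) (trans (mate-ab c i b) e′)) e

  mate-ab-x : ∀ c i s → Mᵢ i (colourIn i c) (x i) (Local.xs i s) → mate c (ab (prev i) s) ≡ hX i s
  mate-ab-x c i s m =
    trans (mate-ab c (prev i) s)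
          (trans (abMate-rightEnd (prev i) s _ (matched-rightEnd i c m)) (cong (λ i′ → hX i′ s) (next-prev i)))

  mate-ab-y : ∀ c i t → Mᵢ i (colourIn i c) (y i) (Local.ys i t) → mate c (ab i t) ≡ hY i t
  mate-ab-y c i t m = trans (mate-ab c i t) (abMate-leftEnd i t _ (matched-leftEnd i c m))

  involutive-h : ∀ c i u .(ux : u ≢ x i) .(uy : u ≢ y i) w → Mᵢ i (colourIn i c) u w →
                 mate c (hMate i u w) ≡ hv i u ux uy
  involutive-h c i u ux uy w u~w with w ≟ x i | w ≟ y i
  ... | yes refl | _ with u ≟ x0 i
  ...   | yes refl = mate-ab-x c i false (PMᵢ.matched-sym i _ u~w)
  ...   | no u≢x0 with x-neighbour i (adj-symm i (PMᵢ.matched-adj i _ u~w))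
  ...     | inj₁ u≡y          = Irrelevant.⊥-elim (uy u≡y)
  ...     | inj₂ (inj₁ u≡x0) = ⊥-elim (u≢x0 u≡x0)
  ...     | inj₂ (inj₂ refl)  = mate-ab-x c i true (PMᵢ.matched-sym i _ u~w)
  involutive-h c i u ux uy w u~w | no _ | yes refl with u ≟ y0 i
  ...   | yes refl = mate-ab-y c i false (PMᵢ.matched-sym i _ u~w)
  ...   | no u≢y0 with y-neighbour i (adj-symm i (PMᵢ.matched-adj i _ u~w))
  ...     | inj₁ u≡x          = Irrelevant.⊥-elim (ux u≡x)
  ...     | inj₂ (inj₁ u≡y0) = ⊥-elim (u≢y0 u≡y0)
  ...     | inj₂ (inj₂ refl)  = mate-ab-y c i true (PMᵢ.matched-sym i _ u~w)
  involutive-h c i u ux uy w u~w | no w≢x | no w≢y =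
    trans (cong (hMate i w) (partnerIn-matched i c (PMᵢ.matched-sym i _ u~w))) (hMate-inner i w u ux uy)

  junction-through⇒spine : ∀ i c {e} → junctionAt i c ≡ through e → slotOf c ≡ spineSlot (toℕ i)
  junction-through⇒spine i c eq with Link.junction (link i (slotOf c)) in eqJ | eq
  ... | through _ | _ = Link.through⇒spine (link i (slotOf c)) eqJ

  spine⇒mate-c : ∀ i c → slotOf c ≡ spineSlot (toℕ i) → mate c (cv i) ≡ spineMate (toℕ i)
  spine⇒mate-c i c onSpine with Link.spine⇒through (link i (slotOf c)) onSpine
  ... | _ , eqJ = cong (λ J → cMate i (shift J (positionOf c))) eqJ

  mate-spineAt-< : ∀ c m (m<k-2 : m < k-2) → mate c (spineAt (suc m)) ≡ vMate (slotOf c) m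
  mate-spineAt-< c m m<k-2 = trans (cong (mate c) (spineAt-< m m<k-2))
                                   (cong (vMate (slotOf c)) (toℕ-fromℕ< m<k-2))

  mate-spineAt-α : ∀ c → slotOf c ≡ α → ∀ q → q < K → mate c (spineAt q) ≡ spineAt (pairUp q)
  mate-spineAt-α c inα 0 _ = spine⇒mate-c 1F c inα
  mate-spineAt-α c inα (suc m) (s≤s m<k-1) with ℕ.m≤n⇒m<n∨m≡n (ℕ.≤-pred m<k-1)
  ... | inj₁ m<k-2 = trans (mate-spineAt-< c m m<k-2) (cong (λ s → vMate s m) inα)
  ... | inj₂ refl  = trans (cong (mate c) spineAt-c₀) (trans (spine⇒mate-c 0F c inα)
                       (cong (spineAt ∘ suc ∘ suc) (sym (pairUp-odd h))))

  mate-spineMate : ∀ c i t → toℕ i ≡ t → slotOf c ≡ spineSlot t → mate c (spineMate t) ≡ cv i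
  mate-spineMate c i 0 e inα = begin
    mate c (spineAt k-2)            ≡⟨ mate-spineAt-< c (suc (h + h)) ℕ.≤-refl ⟩
    vMate (slotOf c) (suc (h + h))  ≡⟨ cong (λ s → vMate s (suc (h + h))) inα ⟩
    spineAt (pairUp k-2)            ≡⟨ cong (spineAt ∘ suc ∘ suc) (pairUp-even h) ⟩
    spineAt (suc k-2)               ≡⟨ spineAt-c₀ ⟩
    cv 0F                           ≡⟨ cong cv (toℕ-injective (sym e)) ⟩
    cv i                            ∎
  mate-spineMate c i 1 e inα = begin
    mate c (spineAt 1)  ≡⟨ mate-spineAt-< c 0 (s≤s z≤n) ⟩
    vMate (slotOf c) 0  ≡⟨ cong (λ s → vMate s 0) inα ⟩
    cv 1F               ≡⟨ cong cv (toℕ-injective (sym e)) ⟩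
    cv i                ∎
  mate-spineMate c i (suc (suc m)) e inγ = begin
    mate c (spineAt (suc m))  ≡⟨ mate-spineAt-< c m m<k-2 ⟩
    vMate (slotOf c) m        ≡⟨ cong (λ s → vMate s m) inγ ⟩
    cAt (suc (suc m))         ≡⟨ cAt-< _ m+2<K ⟩
    cv (fromℕ< m+2<K)         ≡⟨ cong cv (toℕ-injective (trans (toℕ-fromℕ< m+2<K) (sym e))) ⟩
    cv i                      ∎
    where
    m+2<K = subst (_< K) e (toℕ<n i)
    m<k-2 = ℕ.≤-pred (ℕ.≤-pred m+2<K)

  free-left : ∀ i e → abMate i (not e) (left e) ≡ cv i
  free-left i false = refl
  free-left i true  = refl

  free-right : ∀ i e → abMate i (not e) (right e) ≡ cv i
  free-right i false = refl
  free-right i true  = refl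

  involutive-c : ∀ c i → mate c (mate c (cv i)) ≡ cv i
  involutive-c c i = viaJunction (junctionAt i c) refl
    where
    viaJunction : ∀ J → junctionAt i c ≡ J → mate c (cMate i J) ≡ cv i
    viaJunction (through e) eq = mate-spineMate c i (toℕ i) refl (junction-through⇒spine i c eq)
    viaJunction (left e)    eq = trans (mate-ab c i (not e)) (trans (cong (abMate i (not e)) eq) (free-left i e))
    viaJunction (right e)   eq = trans (mate-ab c i (not e)) (trans (cong (abMate i (not e)) eq) (free-right i e))

  involutive-v : ∀ c j → mate c (mate c (vv j)) ≡ vv j
  involutive-v c j = inSlot (slotOf c) refl
    where
    m = toℕ j
    inSlot : ∀ s → slotOf c ≡ s → mate c (vMate s m) ≡ vv j
    inSlot α inα = begin
      mate c (spineAt (pairUp (suc m)))   ≡⟨ mate-spineAt-α c inα _ (pairUp-<K _ m+1<K) ⟩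
      spineAt (pairUp (pairUp (suc m)))   ≡⟨ cong spineAt (pairUp-involutive (suc m)) ⟩
      spineAt (suc m)                     ≡⟨ spineAt-vv j ⟩
      vv j                                ∎
      where m+1<K = j<k-2⇒j+1<K (toℕ<n j)
    inSlot β inβ = begin
      mate c (spineAt (suc (pairUp m)))   ≡⟨ mate-spineAt-< c (pairUp m) (pairUp-<k-2 m (toℕ<n j)) ⟩
      vMate (slotOf c) (pairUp m)         ≡⟨ cong (λ s → vMate s (pairUp m)) inβ ⟩
      spineAt (suc (pairUp (pairUp m)))   ≡⟨ cong (spineAt ∘ suc) (pairUp-involutive m) ⟩
      spineAt (suc m)                     ≡⟨ spineAt-vv j ⟩
      vv j                                ∎
    inSlot γ inγ = begin
      mate c (cAt (suc (suc m)))          ≡⟨ cong (mate c) (cAt-< _ m+2<K) ⟩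
      mate c (cv i)                       ≡⟨ spine⇒mate-c i c (trans inγ (cong spineSlot (sym i≡m+2))) ⟩
      spineMate (toℕ i)                   ≡⟨ cong spineMate i≡m+2 ⟩
      spineAt (suc m)                     ≡⟨ spineAt-vv j ⟩
      vv j                                ∎
      where
      m+2<K = s≤s (s≤s (toℕ<n j))
      i = fromℕ< m+2<K
      i≡m+2 = toℕ-fromℕ< m+2<K

  involutive : ∀ c v → mate c (mate c v) ≡ v
  involutive c (hv i u ux uy) = involutive-h c i u ux uy _ (PMᵢ.partner-matched i (colourIn i c) u)
  involutive c (av i)         = involutive-ab c i false
  involutive c (bv i)         = involutive-ab c i true
  involutive c (cv i)         = involutive-c c i
  involutive c (vv j)         = involutive-v c j

  mate-swap : ∀ c {u v} → mate c u ≡ v → mate c v ≡ u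
  mate-swap c {u} e = trans (cong (mate c) (sym e)) (involutive c u)

  classIn : ∀ i {u w} → T (adj (G i) u w) → Pair (λ c → Mᵢ i (colourIn i c) u w)
  classIn i {u} {w} u~w = pair-↔ (π i) (exactlyTwo⇒pair {toGraph (G i)} (proj₂ (proj₂ (fulkerson i)) u w u~w))

  hv≢cv : ∀ {i i′ u} .{ux uy} → hv i′ u ux uy ≢ cv i
  hv≢cv ()

  ab≢hv : ∀ i b {i′ u} .{ux uy} → ab i b ≢ hv i′ u ux uy
  ab≢hv i false ()
  ab≢hv i true  ()

  hMate-hv : ∀ i u w w′ .(wx : w ≢ x i) .(wy : w ≢ y i) → hMate i u w′ ≡ hv i w wx wy → w′ ≡ w
  hMate-hv i u w w′ wx wy with w′ ≟ x i | w′ ≟ y i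
  ... | yes _ | _     = ⊥-elim ∘ ab≢hv (prev i) _
  ... | no  _ | yes _ = ⊥-elim ∘ ab≢hv i _
  ... | no  _ | no  _ = λ { refl → refl }

  pair-h : ∀ i u w .(ux : u ≢ x i) .(uy : u ≢ y i) .(wx : w ≢ x i) .(wy : w ≢ y i) → T (adj (G i) u w) →
           Pair (λ c → mate c (hv i u ux uy) ≡ hv i w wx wy)
  pair-h i u w ux uy wx wy u~w = pair-⇔
    (λ c m → trans (cong (hMate i u) (partnerIn-matched i c m)) (hMate-inner i u w wx wy))
    (λ c e → subst (Mᵢ i (colourIn i c) u) (hMate-hv i u w _ wx wy e) (PMᵢ.partner-matched i (colourIn i c) u))
    (classIn i u~w)

  hv-index : ∀ {i i′ u u′} .{ux uy ux′ uy′} → hv i u ux uy ≡ hv i′ u′ ux′ uy′ → i ≡ i′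
  hv-index refl = refl

  abMate-hY : ∀ i b J → abMate i b J ≡ hY i b → leftEnd J ≡ just b
  abMate-hY i b J e with abMate-cases i b J
  ... | matesY eJ   = eJ
  ... | matesX eJ   = ⊥-elim (next≢ i (hv-index (trans (sym e) (abMate-rightEnd i b J eJ))))
  ... | matesC _ e′ = ⊥-elim (hv≢cv (trans (sym e) e′))

  abMate-hX : ∀ i b J → abMate i b J ≡ hX (next i) b → rightEnd J ≡ just b
  abMate-hX i b J e with abMate-cases i b J
  ... | matesX eJ   = eJ
  ... | matesY eJ   = ⊥-elim (next≢ i (hv-index (trans (sym (abMate-leftEnd i b J eJ)) e)))
  ... | matesC _ e′ = ⊥-elim (hv≢cv (trans (sym e) e′))

  pair-ab-y : ∀ i b → Pair (λ c → mate c (ab i b) ≡ hY i b)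
  pair-ab-y i b = pair-⇔
    (λ c m → trans (mate-ab c i b) (abMate-leftEnd i b _ (matched-leftEnd i c m)))
    (λ c e → leftEnd-matched i c (abMate-hY i b _ (trans (sym (mate-ab c i b)) e)))
    (classIn i (y~ys i b))

  matched-rightEnd′ : ∀ i c {s} → Mᵢ (next i) (colourIn (next i) c) (x (next i)) (Local.xs (next i) s) →
                      rightEnd (junctionAt i c) ≡ just s
  matched-rightEnd′ i c {s} m =
    subst (λ i′ → rightEnd (junctionAt i′ c) ≡ just s) (prev-next i) (matched-rightEnd (next i) c m)

  pair-ab-x : ∀ i b → Pair (λ c → mate c (ab i b) ≡ hX (next i) b)
  pair-ab-x i b = pair-⇔
    (λ c m → trans (mate-ab c i b) (abMate-rightEnd i b _ (matched-rightEnd′ i c m)))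
    (λ c e → rightEnd-matched i c (abMate-hX i b _ (trans (sym (mate-ab c i b)) e)))
    (classIn (next i) (x~xs (next i) b))

  junctionAt-colour : ∀ i s p → junctionAt i (colour s p) ≡ shift (Link.junction (link i s)) p
  junctionAt-colour i α false = refl
  junctionAt-colour i α true  = refl
  junctionAt-colour i β false = refl
  junctionAt-colour i β true  = refl
  junctionAt-colour i γ false = refl
  junctionAt-colour i γ true  = refl

  offSpine⇒side : ∀ i s → s ≢ spineSlot (toℕ i) → Side (Link.junction (link i s))
  offSpine⇒side i s offSpine with Link.junction (link i s) in eq
  ... | through _ = ⊥-elim (offSpine (Link.through⇒spine (link i s) eq))
  ... | left e    = leftSide e
  ... | right e   = rightSide e

  xor-free : ∀ b e → b xor (e xor not (b xor e)) ≡ true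
  xor-free false false = refl
  xor-free false true  = refl
  xor-free true  false = refl
  xor-free true  true  = refl

  xor-solve : ∀ b e p → b xor (e xor p) ≡ true → p ≡ not (b xor e)
  xor-solve false false true  _ = refl
  xor-solve false true  false _ = refl
  xor-solve true  false false _ = refl
  xor-solve true  true  true  _ = refl

  if-true : ∀ {c} {u u′ w : Vtx} → (if c then u else u′) ≡ w → u′ ≢ w → c ≡ true
  if-true {true}  _ _  = refl
  if-true {false} e ne = ⊥-elim (ne e)

  side-free : ∀ i b J → Side J → abMate i b (shift J (not (b xor base J))) ≡ cv i
  side-free i b (left e)  _ rewrite xor-free b e = refl
  side-free i b (right e) _ rewrite xor-free b e = refl

  free-side : ∀ i b J p → abMate i b (shift J p) ≡ cv i → Side J × p ≡ not (b xor base J)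
  free-side i b (through e) p eq with b xor (e xor p)
  ... | true  = ⊥-elim (hv≢cv eq)
  ... | false = ⊥-elim (hv≢cv eq)
  free-side i b (left e)  p eq = leftSide e , xor-solve b e p (if-true eq λ ())
  free-side i b (right e) p eq = rightSide e , xor-solve b e p (if-true eq λ ())

  pair-ab-c : ∀ i b → Pair (λ c → mate c (ab i b) ≡ cv i)
  pair-ab-c i b = offSlotsPair (spineSlot (toℕ i)) chosen holds only
    where
    chosen : Slot → Bool
    chosen s = not (b xor base (Link.junction (link i s)))
    holds : ∀ b′ → let s = otherSlot (spineSlot (toℕ i)) b′ in mate (colour s (chosen s)) (ab i b) ≡ cv i
    holds b′ = trans (mate-ab _ i b)
                 (trans (cong (abMate i b) (junctionAt-colour i s (chosen s)))
                        (side-free i b _ (offSpine⇒side i s (otherSlot-≢ _ b′))))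
      where s = otherSlot (spineSlot (toℕ i)) b′
    only : ∀ c → mate c (ab i b) ≡ cv i → slotOf c ≢ spineSlot (toℕ i) × positionOf c ≡ chosen (slotOf c)
    only c eq with free-side i b _ (positionOf c) (trans (sym (mate-ab c i b)) eq)
    ... | side , at = onSpine⇒¬side , at
      where
      onSpine⇒¬side : slotOf c ≢ spineSlot (toℕ i)
      onSpine⇒¬side onSpine = through-¬side (proj₂ (Link.spine⇒through (link i (slotOf c)) onSpine)) side

  spineAt-vv-inv : ∀ p j → spineAt p ≡ vv j → p ≡ suc (toℕ j)
  spineAt-vv-inv 0       j ()
  spineAt-vv-inv (suc q) j with q <? k-2
  ... | yes q<k-2 = λ { refl → cong suc (sym (toℕ-fromℕ< q<k-2)) }
  ... | no  _     = λ ()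

  cAt≢vv : ∀ m j → cAt m ≢ vv j
  cAt≢vv m j with m <? K
  ... | yes _ = λ ()
  ... | no  _ = λ ()

  ab≢vv : ∀ i b j → ab i b ≢ vv j
  ab≢vv i false j ()
  ab≢vv i true  j ()

  pair-c-spine : ∀ i j → spineMate (toℕ i) ≡ vv j → Pair (λ c → mate c (cv i) ≡ vv j)
  pair-c-spine i j mate≡ = slotPair (spineSlot (toℕ i))
    (λ b → trans (spine⇒mate-c i _ (slotOf-colour _ b)) mate≡)
    (λ c eq → onSpine c (junctionAt i c) refl eq)
    where
    onSpine : ∀ c J → junctionAt i c ≡ J → cMate i J ≡ vv j → slotOf c ≡ spineSlot (toℕ i)
    onSpine c (through _) eqJ _  = junction-through⇒spine i c eqJ
    onSpine c (left e)    _   eq = ⊥-elim (ab≢vv i (not e) j eq)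
    onSpine c (right e)   _   eq = ⊥-elim (ab≢vv i (not e) j eq)

  -- the path edge v_m v_{m+1} lies in slot α if m is odd and in slot β if m is even
  vMate-vv : ∀ s j → vMate s (suc (toℕ j)) ≡ vv j →
             (s ≡ α × suc (pairUp (toℕ j)) ≡ toℕ j) ⊎ (s ≡ β × pairUp (toℕ j) ≡ suc (toℕ j))
  vMate-vv α j e = inj₁ (refl , ℕ.suc-injective (spineAt-vv-inv _ j e))
  vMate-vv β j e = inj₂ (refl , trans (sym (cong pairUp pairUp[m+1]≡m)) (pairUp-involutive _))
    where pairUp[m+1]≡m = ℕ.suc-injective (spineAt-vv-inv _ j e)
  vMate-vv γ j e = ⊥-elim (cAt≢vv _ j e)

  not-both : ∀ {m} → pairUp m ≡ suc m → suc (pairUp m) ≡ m → ⊥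
  not-both {m} even odd = ℕ.m≢1+n+m m {1} (sym (trans (cong suc (sym even)) odd))

  pair-vv : ∀ j j′ → toℕ j′ ≡ suc (toℕ j) → Pair (λ c → mate c (vv j′) ≡ vv j)
  pair-vv j j′ e with pairUp-step (toℕ j)
  ... | inj₁ even = slotPair β
    (λ b → trans (cong₂ vMate (slotOf-colour β b) e)
                 (trans (cong (spineAt ∘ suc) (trans (cong pairUp (sym even)) (pairUp-involutive _))) (spineAt-vv j)))
    (λ c eq → Sum.[ (λ (_ , odd) → ⊥-elim (not-both even odd)) , proj₁ ]′
                    (vMate-vv (slotOf c) j (trans (cong (vMate (slotOf c)) (sym e)) eq)))
  ... | inj₂ odd  = slotPair α
    (λ b → trans (cong₂ vMate (slotOf-colour α b) e) (trans (cong (spineAt ∘ suc) odd) (spineAt-vv j)))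
    (λ c eq → Sum.[ proj₁ , (λ (_ , even) → ⊥-elim (not-both even odd)) ]′
                    (vMate-vv (slotOf c) j (trans (cong (vMate (slotOf c)) (sym e)) eq)))

  pair-swapped : ∀ {u v} → Pair (λ c → mate c u ≡ v) → Pair (λ c → mate c v ≡ u)
  pair-swapped = pair-⇔ (λ c → mate-swap c) (λ c → mate-swap c)

  pair-edge : ∀ {u v} → E u v → Pair (λ c → mate c u ≡ v)
  pair-edge (eH i u w ux uy wx wy u~w) = pair-h i u w ux uy wx wy u~w
  pair-edge (eAC i)          = pair-ab-c i false
  pair-edge (eBC i)          = pair-ab-c i true
  pair-edge (eAY i _ _)      = pair-ab-y i false
  pair-edge (eBY i _ _)      = pair-ab-y i true
  pair-edge (eAX i j i→j _ _) = subst (λ j → Pair (λ c → mate c (av i) ≡ hX j false))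
                                      (succ-functional (next-succ i) i→j) (pair-ab-x i false)
  pair-edge (eBX i j i→j _ _) = subst (λ j → Pair (λ c → mate c (bv i) ≡ hX j true))
                                      (succ-functional (next-succ i) i→j) (pair-ab-x i true)
  pair-edge (eC0C1 _ _ () _ _)
  pair-edge (eC0V i j i≡0 j≡k-3) = pair-c-spine i j
    (trans (cong spineMate i≡0)
           (trans (cong (spineAt ∘ suc) (ℕ.suc-injective (ℕ.suc-injective (ℕ.suc-injective (sym j≡k-3)))))
                  (spineAt-vv j)))
  pair-edge (eVV j j′ e)     = pair-vv j j′ e
  pair-edge (eVC1 j i j≡0 i≡1) = pair-swapped (pair-c-spine i j
    (trans (cong spineMate i≡1) (trans (cong (spineAt ∘ suc) (sym j≡0)) (spineAt-vv j))))
  pair-edge (eCV i j e)      = pair-c-spine i j (trans (cong spineMate e) (spineAt-vv j))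

  fulkersonCover : HasFulkersonCover Γ
  fulkersonCover =
      (λ c u v → mate c u ≡ v)
    , (λ c → involution⇒perfectMatching (mate c) (adjacent c) (involutive c))
    , λ u v → pair⇒exactlyTwo {Γ} ∘ Sum.[ pair-edge , pair-swapped ∘ pair-edge ]′

theorem3p1 : (k : ℕ) → 2 ∣ k → 4 ≤ k → (D : MData k) → HasFulkersonCover (MGraph D)
theorem3p1 .(q * 2) (divides q refl) = even q
  where
  even : ∀ q → 4 ≤ q * 2 → (D : MData (q * 2)) → HasFulkersonCover (MGraph D)
  even 1 (s≤s (s≤s ()))
  even (suc (suc h)) _ = subst (λ k → (D : MData k) → HasFulkersonCover (MGraph D))
                               (cong (suc ∘ suc ∘ suc ∘ suc) h+h≡h*2) (Cover.fulkersonCover h)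
    where
    h+h≡h*2 : h + h ≡ h * 2
    h+h≡h*2 = trans (cong (h +_) (sym (ℕ.+-identityʳ h))) (ℕ.*-comm 2 h)
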